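{- Let $D=\{0,1\}$ and $n\ge 1$. Every fan $\phi:D^n\to\mathbb{R}$ (upper fan or lower fan) is expressible by the set $\Gamma_{\mathsf{sub},2}$ of finite-valued submodular cost functions on $D$ of arity at most $2$, using at most $1+\lfloor m/2\rfloor$ extra variables, where $m$ is the degree of the polynomial representation of $\phi$. That is, there exist $j\le 1+\lfloor m/2\rfloor$, a function $\phi'(x_1,\dots,x_n,y_1,\dots,y_j)$ which is a nonnegative linear combination of functions from $\Gamma_{\mathsf{sub},2}$ (each applied to some of the variables $x_1,\dots,x_n,y_1,\dots,y_j$), and a constant $\kappa\in\mathbb{R}$, such that $\phi(x_1,\dots,x_n)=\min_{y_1,\dots,y_j\in D}\phi'(x_1,\dots,x_n,y_1,\dots,y_j)+\kappa$ for all $x\in D^n$.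
   Context: A cost function of arity $n$ on a set $D$ is a map $D^n\to\mathbb{R}\cup\{\infty\}$; it is finite-valued if it takes values in $\mathbb{R}$. On $D=\{0,1\}$, $D^n$ is ordered coordinatewise (a lattice with meet = coordinatewise $\min$, join = coordinatewise $\max$). A cost function $\phi$ on $D$ is submodular if $\phi(\min(u,v))+\phi(\max(u,v))\le\phi(u)+\phi(v)$ for all $u,v\in D^n$. For a set $\Gamma$ of cost functions, $\phi$ is expressible by $\Gamma$ if $\phi(x)=\min_{y_1,\dots,y_j}\phi'(x,y_1,\dots,y_j)+\kappa$ for some constant $\kappa$ and some $\phi'$ that is a finite sum $\alpha_1\phi_1+\dots+\alpha_r\phi_r$ with $\alpha_i\ge0$ and $\phi_i\in\Gamma$ applied to tuples of the variables; the $y_i$ are called extra variables. Fans: if $F\subseteq D^n$ is a set of pairwise incomparable elements such that every pair of distinct elements of $F$ has the same join $\bigvee F$ (the condition is vacuous if $|F|\le1$; $\bigvee\emptyset$ is the bottom element), the upper fan $\phi_F$ is defined by $\phi_F(x)=-2$ if $x\ge\bigvee F$, $\phi_F(x)=-1$ if $x\not\ge\bigvee F$ but $x\ge a$ for some $a\in F$, and $\phi_F(x)=0$ otherwise. Dually, if $G$ is a set of pairwise incomparable elements every pair of distinct elements of which has the same meet $\bigwedge G$, the lower fan $\phi_G$ is $-2$ if $x\le\bigwedge G$, $-1$ if $x\not\le\bigwedge G$ but $x\le a$ for some $a\in G$, and $0$ otherwise. A fan is an upper or lower fan. Every function $f:\{0,1\}^n\to\mathbb{R}$ has a unique polynomial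 representation $f(x)=\sum_{I\subseteq\{1,\dots,n\}}a_I\prod_{i\in I}x_i$; its degree is the maximum $|I|$ with $a_I\neq0$. -}

module Defs where

open import Data.Bool using (Bool; true; false; _∧_; _∨_; if_then_else_)
open import Data.Bool.Base using () renaming (_≤_ to _≤ᵇ_)
open import Data.Bool.Properties using () renaming (_≤?_ to _≤ᵇ?_)
open import Data.Nat using (ℕ; zero; suc; _+_)
import Data.Nat as ℕ
open import Data.Fin using (Fin; zero; suc)
open import Data.Fin.Properties using (all?)
open import Data.Integer using (+_)
open import Data.Rational using (ℚ; 0ℚ; 1ℚ; _/_; -_; _⊓_) renaming (_+_ to _+ℚ_; _*_ to _*ℚ_; _≤_ to _≤ℚ_)
open import Data.List using (List; []; _∷_; length; lookup; foldr)
open import Data.List.Relation.Unary.Any using (Any; any?)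
open import Data.Vec.Functional using (Vector; _++_) renaming (_∷_ to _∷ᵛ_)
open import Data.Product using (Σ; ∃; _×_; _,_)
open import Data.Sum using (_⊎_)
open import Function using (_∘_)
open import Relation.Nullary using (¬_; Dec; yes; no)
open import Relation.Binary.PropositionalEquality using (_≡_; _≢_)

-- D = {0,1} is Bool (false = 0, true = 1); D^n is Fin n → Bool.
Pt : ℕ → Set
Pt n = Fin n → Bool

_≤ᵛ_ : ∀ {n} → Pt n → Pt n → Set
x ≤ᵛ y = ∀ i → x i ≤ᵇ y i

_≤ᵛ?_ : ∀ {n} (x y : Pt n) → Dec (x ≤ᵛ y)
x ≤ᵛ? y = all? (λ i → x i ≤ᵇ? y i)

meet : ∀ {n} → Pt n → Pt n → Pt n
meet x y i = x i ∧ y i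

join : ∀ {n} → Pt n → Pt n → Pt n
join x y i = x i ∨ y i

_≈ᵛ_ : ∀ {n} → Pt n → Pt n → Set
x ≈ᵛ y = ∀ i → x i ≡ y i

bot top : ∀ {n} → Pt n
bot _ = false
top _ = true

bigJoin : ∀ {n} → List (Pt n) → Pt n
bigJoin = foldr join bot

bigMeet : ∀ {n} → List (Pt n) → Pt n
bigMeet = foldr meet top

Incomparable : ∀ {n} → Pt n → Pt n → Set
Incomparable a b = ¬ (a ≤ᵛ b) × ¬ (b ≤ᵛ a)

-- F (listed without repetition, which is forced by incomparability at distinct positions)
-- is pairwise incomparable and every pair of distinct elements has join ⋁F
ValidUpper : ∀ {n} → List (Pt n) → Set
ValidUpper F = ∀ (i j : Fin (length F)) → i ≢ j →
  Incomparable (lookup F i) (lookup F j) × (join (lookup F i) (lookup F j) ≈ᵛ bigJoin F)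

ValidLower : ∀ {n} → List (Pt n) → Set
ValidLower G = ∀ (i j : Fin (length G)) → i ≢ j →
  Incomparable (lookup G i) (lookup G j) × (meet (lookup G i) (lookup G j) ≈ᵛ bigMeet G)

minus1 minus2 : ℚ
minus1 = - (+ 1 / 1)
minus2 = - (+ 2 / 1)

upperFan : ∀ {n} → List (Pt n) → Pt n → ℚ
upperFan F x with bigJoin F ≤ᵛ? x | any? (λ a → a ≤ᵛ? x) F
... | yes _ | _     = minus2
... | no _  | yes _ = minus1
... | no _  | no _  = 0ℚ

lowerFan : ∀ {n} → List (Pt n) → Pt n → ℚ
lowerFan G x with x ≤ᵛ? bigMeet G | any? (λ a → x ≤ᵛ? a) G
... | yes _ | _     = minus2
... | no _  | yes _ = minus1
... | no _  | no _  = 0ℚ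

IsFan : ∀ {n} → (Pt n → ℚ) → Set
IsFan {n} φ =
  (Σ (List (Pt n)) λ F → ValidUpper F × (∀ x → φ x ≡ upperFan F x))
  ⊎ (Σ (List (Pt n)) λ G → ValidLower G × (∀ x → φ x ≡ lowerFan G x))

sumFin : ∀ k → (Fin k → ℚ) → ℚ
sumFin zero f = 0ℚ
sumFin (suc k) f = f zero +ℚ sumFin k (f ∘ suc)

prodFin : ∀ k → (Fin k → ℚ) → ℚ
prodFin zero f = 1ℚ
prodFin (suc k) f = f zero *ℚ prodFin k (f ∘ suc)

sumAll : ∀ k → (Pt k → ℚ) → ℚ
sumAll zero g = g (λ ())
sumAll (suc k) g = sumAll k (λ y → g (false ∷ᵛ y)) +ℚ sumAll k (λ y → g (true ∷ᵛ y))

minAll : ∀ k → (Pt k → ℚ) → ℚ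
minAll zero g = g (λ ())
minAll (suc k) g = minAll k (λ y → g (false ∷ᵛ y)) ⊓ minAll k (λ y → g (true ∷ᵛ y))

-- |I| for a subset I ⊆ {1..n} given by its indicator
card : ∀ {n} → Pt n → ℕ
card {zero} I = 0
card {suc n} I = (if I zero then 1 else 0) + card {n} (I ∘ suc)

toℚ : Bool → ℚ
toℚ true = 1ℚ
toℚ false = 0ℚ

monomial : ∀ {n} → Pt n → Pt n → ℚ
monomial {n} I x = prodFin n (λ i → if I i then toℚ (x i) else 1ℚ)

IsPolyRep : ∀ {n} → (Pt n → ℚ) → (Pt n → ℚ) → Set
IsPolyRep {n} f a = ∀ x → f x ≡ sumAll n (λ I → a I *ℚ monomial I x)

IsDegree : ∀ {n} → (Pt n → ℚ) → ℕ → Set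
IsDegree a m = (∀ I → a I ≢ 0ℚ → card I ℕ.≤ m) × (∃ λ I → a I ≢ 0ℚ × card I ≡ m)

Submodular : ∀ k → (Pt k → ℚ) → Set
Submodular k f = ∀ u v → (f (meet u v) +ℚ f (join u v)) ≤ℚ (f u +ℚ f v)

-- one summand α·φᵢ(z_{s(1)},…,z_{s(k)}) with φᵢ ∈ Γ_sub,2, over N variables
record Term (N : ℕ) : Set where
  field
    arity   : ℕ
    arity≤2 : arity ℕ.≤ 2
    fn      : Pt arity → ℚ
    sub     : Submodular arity fn
    coeff   : ℚ
    coeff≥0 : 0ℚ ≤ℚ coeff
    scope   : Fin arity → Fin N

evalTerm : ∀ {N} → Term N → Pt N → ℚ
evalTerm t z = Term.coeff t *ℚ Term.fn t (z ∘ Term.scope t)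

evalTerms : ∀ {N} → List (Term N) → Pt N → ℚ
evalTerms ts z = foldr (λ t acc → evalTerm t z +ℚ acc) 0ℚ ts

ExpressibleSub2With : ∀ {n} → (Pt n → ℚ) → ℕ → Set
ExpressibleSub2With {n} φ j =
  Σ (List (Term (n + j))) λ ts → Σ ℚ λ κ →
    ∀ (x : Pt n) → φ x ≡ minAll j (λ y → evalTerms ts (x ++ y)) +ℚ κ

module Submission where

-- An upper fan with generators aᵢ (i < k, pairwise incomparable, pairwise joining to C) is
-- -2 above C, -1 above some aᵢ, 0 elsewhere; a lower fan is an upper fan read through
-- x ↦ ¬x, so everything is done in a polarity pol, variables being read as pol xor x.
-- With the blocks Bᵢ = C ∧ ¬aᵢ (pairwise disjoint) and the core C₀ = C ∧ ⋀ᵢ aᵢ,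
-- construction I expresses the fan with a fan variable Y and one switch per block of size
-- ≥ 2 (smaller blocks reuse Y), built from the submodular gadgets W ∧ ¬X and -(W ∧ T);
-- construction II expresses -Σᵢ ∏_{aᵢ} with one switch per monomial and is used for k = 2.
-- The variable count is bounded through the degree: the fan is (k-2)·∏_C - Σᵢ ∏_{aᵢ}, so
-- for k ≥ 3 the monomial C survives, |C| ≤ m, and the disjoint blocks inside C give
-- 2·#(big blocks) ≤ m; for k = 2 both aᵢ survive, bounding the blocks inside them.

open import Defs
open import Data.Nat using (ℕ; _≤_; _+_; _/_)
open import Data.Rational using (ℚ)
open import Data.Product using (Σ; _×_)

open import Data.Bool using (Bool; true; false; _∧_; _∨_; not; if_then_else_; _xor_; T)
open import Data.Bool.Base using () renaming (_≤_ to _≤ᵇ_; f≤t to f≤ᵇt; b≤b to b≤ᵇb)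
open import Data.Bool.Properties using (∧-conicalˡ; ∧-conicalʳ; xor-assoc; xor-same)
  renaming (_≤?_ to _≤ᵇ?_; _≟_ to _≟ᵇ_)
import Data.Nat as N
import Data.Nat.Properties as NP
import Data.Nat.DivMod as DM
open import Data.Nat using (zero; suc)
open import Data.Fin using (Fin; zero; suc; _↑ˡ_; _↑ʳ_)
import Data.Fin.Properties as FP
open import Data.Rational using (0ℚ; 1ℚ) renaming (_+_ to _+ℚ_; _*_ to _*ℚ_; _≤_ to _≤ℚ_; -_ to -ℚ_)
import Data.Rational.Properties as QP
open import Data.Rational.Solver using (module +-*-Solver)
open import Data.Vec.Functional using () renaming (_∷_ to _∷ᵛ_; _++_ to _++ᵛ_)
import Data.Vec.Functional.Properties as VFP
open import Data.Product using (_,_; proj₁; proj₂)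
open import Data.Sum using (_⊎_; inj₁; inj₂)
open import Data.Unit using (tt)
open import Data.Empty using (⊥; ⊥-elim)
open import Function using (_∘_; case_of_)
open import Data.List using (List; []; _∷_; length; lookup) renaming (_++_ to _++ˡ_)
open import Data.List.Relation.Unary.Any using (Any; any?)
import Data.List.Relation.Unary.Any as Any
import Data.List.Relation.Unary.Any.Properties as AnyP
open import Data.List.Membership.Propositional using (lose)
open import Data.List.Membership.Propositional.Properties using (∈-lookup)
open import Relation.Nullary using (¬_; Dec; yes; no; does; ¬?; _→-dec_)
open import Relation.Nullary.Decidable using (dec-true; dec-false)
open import Relation.Binary.PropositionalEquality
open +-*-Solver

≡⇒≤ : ∀ {p q} → p ≡ q → p ≤ℚ q
≡⇒≤ = QP.≤-reflexive

toℚ-nonneg : ∀ b → 0ℚ ≤ℚ toℚ b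
toℚ-nonneg true = QP.≤ᵇ⇒≤ tt
toℚ-nonneg false = QP.≤-refl

≤-+ˡ : ∀ {r p q} → 0ℚ ≤ℚ r → p ≤ℚ q → p ≤ℚ r +ℚ q
≤-+ˡ {r} {p} {q} r≥0 p≤q = subst (_≤ℚ r +ℚ q) (QP.+-identityˡ p) (QP.+-mono-≤ r≥0 p≤q)

≤-+ʳ : ∀ {r p q} → 0ℚ ≤ℚ r → p ≤ℚ q → p ≤ℚ q +ℚ r
≤-+ʳ {r} {p} {q} r≥0 p≤q = subst (_≤ℚ q +ℚ r) (QP.+-identityʳ p) (QP.+-mono-≤ p≤q r≥0)

sumFin-cong : ∀ k {f g : Fin k → ℚ} → (∀ i → f i ≡ g i) → sumFin k f ≡ sumFin k g
sumFin-cong zero f≡g = refl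
sumFin-cong (suc k) f≡g = cong₂ _+ℚ_ (f≡g zero) (sumFin-cong k (f≡g ∘ suc))

sumFin-zero : ∀ k {f : Fin k → ℚ} → (∀ i → f i ≡ 0ℚ) → sumFin k f ≡ 0ℚ
sumFin-zero zero f≡0 = refl
sumFin-zero (suc k) f≡0 = cong₂ _+ℚ_ (f≡0 zero) (sumFin-zero k (f≡0 ∘ suc))

sumFin-mono : ∀ k {f g : Fin k → ℚ} → (∀ i → f i ≤ℚ g i) → sumFin k f ≤ℚ sumFin k g
sumFin-mono zero f≤g = QP.≤-refl
sumFin-mono (suc k) f≤g = QP.+-mono-≤ (f≤g zero) (sumFin-mono k (f≤g ∘ suc))

sumFin-nonneg : ∀ k {f : Fin k → ℚ} → (∀ i → 0ℚ ≤ℚ f i) → 0ℚ ≤ℚ sumFin k f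
sumFin-nonneg k {f} f≥0 =
  subst (_≤ℚ sumFin k f) (sumFin-zero k {λ _ → 0ℚ} (λ _ → refl)) (sumFin-mono k f≥0)

sumFin-single : ∀ k {f : Fin k → ℚ} (i : Fin k) → (∀ j → j ≢ i → f j ≡ 0ℚ) → sumFin k f ≡ f i
sumFin-single (suc k) {f} zero others = trans (cong (f zero +ℚ_) (sumFin-zero k (λ j → others (suc j) λ ()))) (QP.+-identityʳ _)
sumFin-single (suc k) {f} (suc i) others =
  trans (cong₂ _+ℚ_ (others zero λ ())
                    (sumFin-single k i (λ j j≢i → others (suc j) (j≢i ∘ FP.suc-injective))))
        (QP.+-identityˡ _)

sumFin-≥term : ∀ k {f : Fin k → ℚ} (i : Fin k) → (∀ j → 0ℚ ≤ℚ f j) → f i ≤ℚ sumFin k f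
sumFin-≥term (suc k) zero f≥0 = ≤-+ʳ (sumFin-nonneg k (f≥0 ∘ suc)) QP.≤-refl
sumFin-≥term (suc k) (suc i) f≥0 = ≤-+ˡ (f≥0 zero) (sumFin-≥term k i (f≥0 ∘ suc))

sumFin-≥two : ∀ k {f : Fin k → ℚ} (i j : Fin k) → i ≢ j → (∀ l → 0ℚ ≤ℚ f l) → f i +ℚ f j ≤ℚ sumFin k f
sumFin-≥two (suc k) zero zero i≢j f≥0 = ⊥-elim (i≢j refl)
sumFin-≥two (suc k) {f} zero (suc j) i≢j f≥0 = QP.+-monoʳ-≤ (f zero) (sumFin-≥term k j (f≥0 ∘ suc))
sumFin-≥two (suc k) {f} (suc i) zero i≢j f≥0 =
  subst (_≤ℚ sumFin (suc k) f) (QP.+-comm (f zero) (f (suc i))) (QP.+-monoʳ-≤ (f zero) (sumFin-≥term k i (f≥0 ∘ suc)))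
sumFin-≥two (suc k) (suc i) (suc j) i≢j f≥0 = ≤-+ˡ (f≥0 zero) (sumFin-≥two k i j (i≢j ∘ cong suc) (f≥0 ∘ suc))

sumFin-neg : ∀ k (f : Fin k → ℚ) → sumFin k (λ i → -ℚ f i) ≡ -ℚ sumFin k f
sumFin-neg zero f = refl
sumFin-neg (suc k) f =
  trans (cong ((-ℚ f zero) +ℚ_) (sumFin-neg k (f ∘ suc))) (sym (QP.neg-distrib-+ (f zero) (sumFin k (f ∘ suc))))

-- minAll only inspects points built by _∷ᵛ_, so the point attaining the minimum is given
-- in that normal form.

normalForm : ∀ j → Pt j → Pt j
normalForm zero y = λ ()
normalForm (suc j) y = y zero ∷ᵛ normalForm j (y ∘ suc)

normalForm-≈ : ∀ j (y : Pt j) i → normalForm j y i ≡ y i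
normalForm-≈ (suc j) y zero = refl
normalForm-≈ (suc j) y (suc i) = normalForm-≈ j (y ∘ suc) i

minAll-glb : ∀ j (g : Pt j → ℚ) v → (∀ y → v ≤ℚ g y) → v ≤ℚ minAll j g
minAll-glb zero g v v≤g = v≤g _
minAll-glb (suc j) g v v≤g = QP.⊓-glb (minAll-glb j _ v (λ y → v≤g _)) (minAll-glb j _ v (λ y → v≤g _))

minAll-≤ : ∀ j (g : Pt j → ℚ) y → minAll j g ≤ℚ g (normalForm j y)
minAll-≤ zero g y = QP.≤-refl
minAll-≤ (suc j) g y with y zero
... | false = QP.≤-trans (QP.p⊓q≤p (minAll j (λ u → g (false ∷ᵛ u))) _) (minAll-≤ j (λ u → g (false ∷ᵛ u)) (y ∘ suc))
... | true = QP.≤-trans (QP.p⊓q≤q (minAll j (λ u → g (false ∷ᵛ u))) _) (minAll-≤ j (λ u → g (true ∷ᵛ u)) (y ∘ suc))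

minAll-attained : ∀ j (g : Pt j → ℚ) v → (∀ y → v ≤ℚ g y) → (y : Pt j) → g (normalForm j y) ≡ v → minAll j g ≡ v
minAll-attained j g v v≤g y gy≡v = QP.≤-antisym (QP.≤-trans (minAll-≤ j g y) (≡⇒≤ gy≡v)) (minAll-glb j g v v≤g)

BinSubmodular : (Bool → Bool → ℚ) → Set
BinSubmodular g = ∀ a b c d → g (a ∧ c) (b ∧ d) +ℚ g (a ∨ c) (b ∨ d) ≤ℚ g a b +ℚ g c d

swap : ∀ p {q r} → p +ℚ q ≤ℚ r → q +ℚ p ≤ℚ r
swap p {q} p+q≤r = subst (_≤ℚ _) (QP.+-comm p q) p+q≤r

-- a binary function is submodular once its diagonal is dominated by its antidiagonal: any
-- other two arguments are comparable, and then the inequality is an equality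
binSubmodular : ∀ g → g false false +ℚ g true true ≤ℚ g true false +ℚ g false true → BinSubmodular g
binSubmodular g crit true  true  c     d     = ≡⇒≤ (QP.+-comm (g c d) (g true true))
binSubmodular g crit false false c     d     = QP.≤-refl
binSubmodular g crit true  false true  true  = QP.≤-refl
binSubmodular g crit true  false true  false = QP.≤-refl
binSubmodular g crit true  false false true  = crit
binSubmodular g crit true  false false false = ≡⇒≤ (QP.+-comm (g false false) (g true false))
binSubmodular g crit false true  true  true  = QP.≤-refl
binSubmodular g crit false true  true  false = QP.≤-trans crit (≡⇒≤ (QP.+-comm (g true false) (g false true)))
binSubmodular g crit false true  false true  = QP.≤-refl
binSubmodular g crit false true  false false = ≡⇒≤ (QP.+-comm (g false false) (g false true))

-- complementing both arguments swaps meets and joins, hence preserves submodularity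
binSubmodular-not : ∀ g → BinSubmodular g → BinSubmodular (λ u v → g (not u) (not v))
binSubmodular-not g sub true  true  c d = swap (g false false) (sub false false (not c) (not d))
binSubmodular-not g sub true  false c d = swap (g false (not d)) (sub false true (not c) (not d))
binSubmodular-not g sub false true  c d = swap (g (not c) false) (sub true false (not c) (not d))
binSubmodular-not g sub false false c d = swap (g (not c) (not d)) (sub true true (not c) (not d))

atPolarity : Bool → (Bool → Bool → ℚ) → Bool → Bool → ℚ
atPolarity pol g u v = g (pol xor u) (pol xor v)

binSubmodular-pol : ∀ pol g → BinSubmodular g → BinSubmodular (atPolarity pol g)
binSubmodular-pol false g sub = sub
binSubmodular-pol true g sub = binSubmodular-not g sub

-- every unary function is submodular: a meet and a join of two values are those values
unarySubmodular : (h : Bool → ℚ) → ∀ a c → h (a ∧ c) +ℚ h (a ∨ c) ≤ℚ h a +ℚ h c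
unarySubmodular h true true = QP.≤-refl
unarySubmodular h true false = ≡⇒≤ (QP.+-comm (h false) (h true))
unarySubmodular h false c = QP.≤-refl

andNot : Bool → Bool → ℚ
andNot w x = toℚ (w ∧ not x)

negAnd : Bool → Bool → ℚ
negAnd w t = -ℚ toℚ (w ∧ t)

andNot-submodular : BinSubmodular andNot
andNot-submodular = binSubmodular andNot (QP.≤ᵇ⇒≤ tt)

negAnd-submodular : BinSubmodular negAnd
negAnd-submodular = binSubmodular negAnd (QP.≤ᵇ⇒≤ tt)

binTerm : ∀ {N} (g : Bool → Bool → ℚ) → BinSubmodular g → Bool → Fin N → Fin N → Term N
binTerm g sub pol v u = record
  { arity = 2 ; arity≤2 = N.s≤s (N.s≤s N.z≤n)
  ; fn = λ b → atPolarity pol g (b zero) (b (suc zero))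
  ; sub = λ p q → binSubmodular-pol pol g sub (p zero) (p (suc zero)) (q zero) (q (suc zero))
  ; coeff = 1ℚ ; coeff≥0 = QP.≤ᵇ⇒≤ tt
  ; scope = λ { zero → v ; (suc zero) → u } }

unaryTerm : ∀ {N} (c : ℚ) → Bool → Fin N → Term N
unaryTerm c pol v = record
  { arity = 1 ; arity≤2 = N.s≤s N.z≤n
  ; fn = λ b → c *ℚ toℚ (pol xor b zero)
  ; sub = λ p q → unarySubmodular (λ b → c *ℚ toℚ (pol xor b)) (p zero) (q zero)
  ; coeff = 1ℚ ; coeff≥0 = QP.≤ᵇ⇒≤ tt
  ; scope = λ _ → v }

eval-binTerm : ∀ {N} g sub pol (v u : Fin N) z → evalTerm (binTerm g sub pol v u) z ≡ g (pol xor z v) (pol xor z u)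
eval-binTerm g sub pol v u z = QP.*-identityˡ _

eval-unaryTerm : ∀ {N} c pol (v : Fin N) z → evalTerm (unaryTerm c pol v) z ≡ c *ℚ toℚ (pol xor z v)
eval-unaryTerm c pol v z = QP.*-identityˡ _

evalTerms-++ : ∀ {N} (ts us : List (Term N)) z → evalTerms (ts ++ˡ us) z ≡ evalTerms ts z +ℚ evalTerms us z
evalTerms-++ [] us z = sym (QP.+-identityˡ _)
evalTerms-++ (t ∷ ts) us z =
  trans (cong (evalTerm t z +ℚ_) (evalTerms-++ ts us z)) (sym (QP.+-assoc (evalTerm t z) (evalTerms ts z) (evalTerms us z)))

concatFin : ∀ {A : Set} k → (Fin k → List A) → List A
concatFin zero ts = []
concatFin (suc k) ts = ts zero ++ˡ concatFin k (ts ∘ suc)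

evalTerms-concatFin : ∀ {N} k (ts : Fin k → List (Term N)) z →
  evalTerms (concatFin k ts) z ≡ sumFin k (λ i → evalTerms (ts i) z)
evalTerms-concatFin zero ts z = refl
evalTerms-concatFin (suc k) ts z =
  trans (evalTerms-++ (ts zero) _ z) (cong (evalTerms (ts zero) z +ℚ_) (evalTerms-concatFin k (ts ∘ suc) z))

termsOver : ∀ {N} n → Pt n → (Fin n → Term N) → List (Term N)
termsOver n S t = concatFin n (λ e → if S e then t e ∷ [] else [])

evalTerms-termsOver : ∀ {N} n S (t : Fin n → Term N) z →
  evalTerms (termsOver n S t) z ≡ sumFin n (λ e → if S e then evalTerm (t e) z else 0ℚ)
evalTerms-termsOver n S t z = trans (evalTerms-concatFin n _ z) (sumFin-cong n single)
  where
  single : ∀ e → evalTerms (if S e then t e ∷ [] else []) z ≡ (if S e then evalTerm (t e) z else 0ℚ)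
  single e with S e
  ... | true = QP.+-identityʳ _
  ... | false = refl

≤ᵛ-intro : ∀ {n} {S X : Pt n} → (∀ e → S e ≡ true → X e ≡ true) → S ≤ᵛ X
≤ᵛ-intro {S = S} {X} S⊆X e with S e in se | X e in xe
... | false | false = b≤ᵇb
... | false | true = f≤ᵇt
... | true | true = b≤ᵇb
... | true | false = case trans (sym (S⊆X e se)) xe of λ ()

≤ᵛ-elim : ∀ {n} {S X : Pt n} → S ≤ᵛ X → ∀ e → S e ≡ true → X e ≡ true
≤ᵛ-elim {S = S} {X} S≤X e se with S e | X e | S≤X e
≤ᵛ-elim S≤X e () | false | _ | _
... | true | true | _ = refl

≤ᵛ-trans : ∀ {n} {A B C : Pt n} → A ≤ᵛ B → B ≤ᵛ C → A ≤ᵛ C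
≤ᵛ-trans A≤B B≤C = ≤ᵛ-intro (λ e → ≤ᵛ-elim B≤C e ∘ ≤ᵛ-elim A≤B e)

≤ᵛ-respʳ : ∀ {n} {S X X' : Pt n} → X ≈ᵛ X' → S ≤ᵛ X → S ≤ᵛ X'
≤ᵛ-respʳ X≈X' S≤X = ≤ᵛ-intro (λ e → trans (sym (X≈X' e)) ∘ ≤ᵛ-elim S≤X e)

≤ᵛ-respˡ : ∀ {n} {S S' X : Pt n} → S ≈ᵛ S' → S ≤ᵛ X → S' ≤ᵛ X
≤ᵛ-respˡ S≈S' S≤X = ≤ᵛ-intro (λ e → ≤ᵛ-elim S≤X e ∘ trans (S≈S' e))

missed-element : ∀ {n} (S X : Pt n) → ¬ (S ≤ᵛ X) → Σ (Fin n) λ e → (S e ≡ true) × (X e ≡ false)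
missed-element {n} S X S≰X with FP.¬∀⟶∃¬ n (λ i → S i ≤ᵇ X i) (λ i → S i ≤ᵇ? X i) S≰X
... | e , Se≰Xe with S e in se | X e in xe
...   | true | false = e , se , xe
...   | true | true = ⊥-elim (Se≰Xe b≤ᵇb)
...   | false | true = ⊥-elim (Se≰Xe f≤ᵇt)
...   | false | false = ⊥-elim (Se≰Xe b≤ᵇb)

card≥1 : ∀ {n} (S : Pt n) e → S e ≡ true → 1 ≤ card S
card≥1 S zero se rewrite se = N.s≤s N.z≤n
card≥1 {suc n} S (suc e) se = NP.≤-trans (card≥1 (S ∘ suc) e se) (NP.m≤n+m (card (S ∘ suc)) _)

card≥2 : ∀ {n} (S : Pt n) e e' → e ≢ e' → S e ≡ true → S e' ≡ true → 2 ≤ card S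
card≥2 S zero zero e≢e' _ _ = ⊥-elim (e≢e' refl)
card≥2 S zero (suc e') e≢e' se se' rewrite se = N.s≤s (card≥1 (S ∘ suc) e' se')
card≥2 S (suc e) zero e≢e' se se' rewrite se' = N.s≤s (card≥1 (S ∘ suc) e se)
card≥2 {suc n} S (suc e) (suc e') e≢e' se se' =
  NP.≤-trans (card≥2 (S ∘ suc) e e' (e≢e' ∘ cong suc) se se') (NP.m≤n+m (card (S ∘ suc)) _)

-- uncovered S W X = Σ_{e ∈ S} W ∧ ¬Xₑ counts the elements of S missed by X, when W is on;
-- block S W T X = -(W ∧ T) + uncovered S W X rewards W (together with T) exactly when X
-- covers S.

uncovered : ∀ n → Pt n → Bool → Pt n → ℚ
uncovered n S W X = sumFin n (λ e → if S e then andNot W (X e) else 0ℚ)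

block : ∀ n → Pt n → Bool → Bool → Pt n → ℚ
block n S W T X = negAnd W T +ℚ uncovered n S W X

uncovered-cong : ∀ n S W {X X'} → X ≈ᵛ X' → uncovered n S W X ≡ uncovered n S W X'
uncovered-cong n S W X≈X' = sumFin-cong n (λ e → cong (λ x → if S e then andNot W x else 0ℚ) (X≈X' e))

block-cong : ∀ n S W T {X X'} → X ≈ᵛ X' → block n S W T X ≡ block n S W T X'
block-cong n S W T X≈X' = cong (negAnd W T +ℚ_) (uncovered-cong n S W X≈X')

uncovered-nonneg : ∀ n S W X → 0ℚ ≤ℚ uncovered n S W X
uncovered-nonneg n S W X = sumFin-nonneg n term≥0
  where
  term≥0 : ∀ e → 0ℚ ≤ℚ (if S e then andNot W (X e) else 0ℚ)
  term≥0 e with S e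
  ... | true = toℚ-nonneg (W ∧ not (X e))
  ... | false = QP.≤-refl

uncovered-covered : ∀ n S W X → S ≤ᵛ X → uncovered n S W X ≡ 0ℚ
uncovered-covered n S W X S≤X = sumFin-zero n term≡0
  where
  off : ∀ W → andNot W true ≡ 0ℚ
  off true = refl
  off false = refl
  term≡0 : ∀ e → (if S e then andNot W (X e) else 0ℚ) ≡ 0ℚ
  term≡0 e with S e | X e | S≤X e
  ... | true | true | _ = off W
  ... | false | _ | _ = refl

uncovered-off : ∀ n S X → uncovered n S false X ≡ 0ℚ
uncovered-off n S X = sumFin-zero n term≡0
  where
  term≡0 : ∀ e → (if S e then andNot false (X e) else 0ℚ) ≡ 0ℚ
  term≡0 e with S e
  ... | true = refl
  ... | false = refl

uncovered-missed : ∀ n S X → ¬ (S ≤ᵛ X) → 1ℚ ≤ℚ uncovered n S true X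
uncovered-missed n S X S≰X with missed-element S X S≰X
... | e , se , xe = QP.≤-trans (≡⇒≤ missed) (sumFin-≥term n e term≥0)
  where
  missed : 1ℚ ≡ (if S e then andNot true (X e) else 0ℚ)
  missed rewrite se | xe = refl
  term≥0 : ∀ e → 0ℚ ≤ℚ (if S e then andNot true (X e) else 0ℚ)
  term≥0 e with S e
  ... | true = toℚ-nonneg (not (X e))
  ... | false = QP.≤-refl

uncovered-small : ∀ n S X → card S ≤ 1 → ¬ (S ≤ᵛ X) → uncovered n S true X ≡ 1ℚ
uncovered-small n S X |S|≤1 S≰X with missed-element S X S≰X
... | e , se , xe = trans (sumFin-single n e others) missed
  where
  others : ∀ e' → e' ≢ e → (if S e' then andNot true (X e') else 0ℚ) ≡ 0ℚ
  others e' e'≢e with S e' in se'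
  ... | true = ⊥-elim (NP.<⇒≱ (card≥2 S e' e e'≢e se' se) |S|≤1)
  ... | false = refl
  missed : (if S e then andNot true (X e) else 0ℚ) ≡ 1ℚ
  missed rewrite se | xe = refl

block-covered-≥ : ∀ n S X → S ≤ᵛ X → ∀ W T → -ℚ toℚ T ≤ℚ block n S W T X
block-covered-≥ n S X S≤X true T = ≡⇒≤ (sym (trans (cong (negAnd true T +ℚ_) (uncovered-covered n S true X S≤X)) (QP.+-identityʳ _)))
block-covered-≥ n S X S≤X false true = QP.≤-trans (QP.≤ᵇ⇒≤ tt) (≡⇒≤ (sym (cong (negAnd false true +ℚ_) (uncovered-off n S X))))
block-covered-≥ n S X S≤X false false = ≡⇒≤ (sym (cong (negAnd false false +ℚ_) (uncovered-off n S X)))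

block-missed-≥ : ∀ n S X → ¬ (S ≤ᵛ X) → ∀ W T → 0ℚ ≤ℚ block n S W T X
block-missed-≥ n S X S≰X true true = QP.+-monoʳ-≤ (-ℚ 1ℚ) (uncovered-missed n S X S≰X)
block-missed-≥ n S X S≰X true false = ≤-+ˡ QP.≤-refl (uncovered-nonneg n S true X)
block-missed-≥ n S X S≰X false T = ≡⇒≤ (sym (trans (cong (negAnd false T +ℚ_) (uncovered-off n S X)) (off T)))
  where
  off : ∀ T → negAnd false T +ℚ 0ℚ ≡ 0ℚ
  off true = refl
  off false = refl

block-covered : ∀ n S X → S ≤ᵛ X → ∀ T → block n S T T X ≡ -ℚ toℚ T
block-covered n S X S≤X true = cong (negAnd true true +ℚ_) (uncovered-covered n S true X S≤X)
block-covered n S X S≤X false = cong (negAnd false false +ℚ_) (uncovered-covered n S false X S≤X)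

block-off : ∀ n S X T → block n S false T X ≡ 0ℚ
block-off n S X true = cong (negAnd false true +ℚ_) (uncovered-off n S X)
block-off n S X false = cong (negAnd false false +ℚ_) (uncovered-off n S X)

block-small : ∀ n S X → card S ≤ 1 → ¬ (S ≤ᵛ X) → block n S true true X ≡ 0ℚ
block-small n S X |S|≤1 S≰X = cong (negAnd true true +ℚ_) (uncovered-small n S X |S|≤1 S≰X)

xor-involutive : ∀ p b → p xor (p xor b) ≡ b
xor-involutive p b = trans (sym (xor-assoc p p b)) (cong (_xor b) (xor-same p))

module Layout (n j : ℕ) (pol : Bool) where
  xVar : Fin n → Fin (n + j)
  xVar e = e ↑ˡ j

  yVar : Fin j → Fin (n + j)
  yVar r = n ↑ʳ r

  read : Pt (n + j) → Fin (n + j) → Bool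
  read z v = pol xor z v

  penaltyTerms : Pt n → Fin (n + j) → List (Term (n + j))
  penaltyTerms S w = termsOver n S (λ e → binTerm andNot andNot-submodular pol w (xVar e))

  blockTerms : Pt n → Fin (n + j) → Fin (n + j) → List (Term (n + j))
  blockTerms S w t = binTerm negAnd negAnd-submodular pol w t ∷ penaltyTerms S w

  eval-penaltyTerms : ∀ S w z → evalTerms (penaltyTerms S w) z ≡ uncovered n S (read z w) (read z ∘ xVar)
  eval-penaltyTerms S w z = trans (evalTerms-termsOver n S _ z) (sumFin-cong n term)
    where
    term : ∀ e → (if S e then evalTerm (binTerm andNot andNot-submodular pol w (xVar e)) z else 0ℚ)
               ≡ (if S e then andNot (read z w) (read z (xVar e)) else 0ℚ)
    term e with S e
    ... | true = eval-binTerm andNot andNot-submodular pol w (xVar e) z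
    ... | false = refl

  eval-blockTerms : ∀ S w t z → evalTerms (blockTerms S w t) z ≡ block n S (read z w) (read z t) (read z ∘ xVar)
  eval-blockTerms S w t z = cong₂ _+ℚ_ (eval-binTerm negAnd negAnd-submodular pol w t z) (eval-penaltyTerms S w z)

  read-x : ∀ x y e → read (x ++ᵛ y) (xVar e) ≡ pol xor x e
  read-x x y e = cong (pol xor_) (VFP.lookup-++ˡ x y e)

  realise : Pt j → Pt j
  realise D = normalForm j (λ r → pol xor D r)

  read-y : ∀ x D r → read (x ++ᵛ realise D) (yVar r) ≡ D r
  read-y x D r =
    trans (cong (pol xor_) (trans (VFP.lookup-++ʳ x _ r) (normalForm-≈ j _ r))) (xor-involutive pol (D r))

expressible-by-minimum : ∀ {n j} (φ : Pt n → ℚ) (ts : List (Term (n + j))) →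
  (∀ x y → φ x ≤ℚ evalTerms ts (x ++ᵛ y)) →
  (∀ x → Σ (Pt j) λ y → evalTerms ts (x ++ᵛ normalForm j y) ≡ φ x) →
  ExpressibleSub2With φ j
expressible-by-minimum {j = j} φ ts lower attained =
  ts , 0ℚ , λ x → sym (trans (QP.+-identityʳ _)
                         (minAll-attained j _ (φ x) (lower x) (proj₁ (attained x)) (proj₂ (attained x))))

joinFin : ∀ {n} k → (Fin k → Pt n) → Pt n
joinFin zero a = bot
joinFin (suc k) a = join (a zero) (joinFin k (a ∘ suc))

meetFin : ∀ {n} k → (Fin k → Pt n) → Pt n
meetFin zero a = top
meetFin (suc k) a = meet (a zero) (meetFin k (a ∘ suc))

joinFin-upper : ∀ {n} k (a : Fin k → Pt n) i e → a i e ≡ true → joinFin k a e ≡ true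
joinFin-upper (suc k) a zero e aie rewrite aie = refl
joinFin-upper (suc k) a (suc i) e aie rewrite joinFin-upper k (a ∘ suc) i e aie with a zero e
... | true = refl
... | false = refl

meetFin-lower : ∀ {n} k (a : Fin k → Pt n) i e → meetFin k a e ≡ true → a i e ≡ true
meetFin-lower (suc k) a zero e m = ∧-conicalˡ _ _ m
meetFin-lower (suc k) a (suc i) e m = meetFin-lower k (a ∘ suc) i e (∧-conicalʳ (a zero e) _ m)

meetFin-greatest : ∀ {n} k (a : Fin k → Pt n) e → (∀ i → a i e ≡ true) → meetFin k a e ≡ true
meetFin-greatest zero a e all = refl
meetFin-greatest (suc k) a e all rewrite all zero = meetFin-greatest k (a ∘ suc) e (all ∘ suc)

∨-true : ∀ a b → a ∨ b ≡ true → (a ≡ true) ⊎ (b ≡ true)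
∨-true true b _ = inj₁ refl
∨-true false b b≡true = inj₂ b≡true

module Fan {n : ℕ} (k : ℕ) (a : Fin k → Pt n) where

  C : Pt n
  C = joinFin k a

  B : Fin k → Pt n
  B i e = C e ∧ not (a i e)

  C₀ : Pt n
  C₀ e = C e ∧ meetFin k a e

  record Valid : Set where
    field
      incomparable : ∀ i j → i ≢ j → Incomparable (a i) (a j)
      joinPair     : ∀ i j → i ≢ j → join (a i) (a j) ≈ᵛ C

  record FanValue (v : ℚ) (X : Pt n) : Set where
    field
      aboveTop : C ≤ᵛ X → v ≡ minus2
      aboveGen : ¬ (C ≤ᵛ X) → (Σ (Fin k) λ i → a i ≤ᵛ X) → v ≡ minus1
      below    : ¬ (C ≤ᵛ X) → ¬ (Σ (Fin k) λ i → a i ≤ᵛ X) → v ≡ 0ℚ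

  FanValue-≤0 : ∀ {v X} → FanValue v X → v ≤ℚ 0ℚ
  FanValue-≤0 {v} {X} fv with C ≤ᵛ? X
  ... | yes C≤X = QP.≤-trans (≡⇒≤ (FanValue.aboveTop fv C≤X)) (QP.≤ᵇ⇒≤ tt)
  ... | no C≰X with FP.any? (λ i → a i ≤ᵛ? X)
  ...   | yes gen = QP.≤-trans (≡⇒≤ (FanValue.aboveGen fv C≰X gen)) (QP.≤ᵇ⇒≤ tt)
  ...   | no none = ≡⇒≤ (FanValue.below fv C≰X none)

  gen≤top : ∀ i → a i ≤ᵛ C
  gen≤top i = ≤ᵛ-intro (joinFin-upper k a i)

  block≤top : ∀ i → B i ≤ᵛ C
  block≤top i = ≤ᵛ-intro (λ e → ∧-conicalˡ (C e) _)

  core≤top : C₀ ≤ᵛ C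
  core≤top = ≤ᵛ-intro (λ e → ∧-conicalˡ (C e) _)

  core≤gen : ∀ i → C₀ ≤ᵛ a i
  core≤gen i = ≤ᵛ-intro (λ e → meetFin-lower k a i e ∘ ∧-conicalʳ (C e) _)

  top-covering : ∀ e → C e ≡ true → (C₀ e ≡ true) ⊎ (Σ (Fin k) λ l → (a l e ≡ false) × (B l e ≡ true))
  top-covering e Ce with FP.all? {P = λ i → a i e ≡ true} (λ i → a i e ≟ᵇ true)
  ... | yes all = inj₁ (subst (λ c → c ∧ meetFin k a e ≡ true) (sym Ce) (meetFin-greatest k a e all))
  ... | no ¬all with FP.¬∀⟶∃¬ k (λ i → a i e ≡ true) (λ i → a i e ≟ᵇ true) ¬all
  ...   | l , ale≢true = inj₂ (l , ale≡false , subst (λ c → c ∧ not (a l e) ≡ true) (sym Ce) (cong not ale≡false))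
    where
    ale≡false : a l e ≡ false
    ale≡false with a l e
    ... | true = ⊥-elim (ale≢true refl)
    ... | false = refl

  top-from-blocks : ∀ X → C₀ ≤ᵛ X → (∀ i → B i ≤ᵛ X) → C ≤ᵛ X
  top-from-blocks X C₀≤X B≤X = ≤ᵛ-intro covered
    where
    covered : ∀ e → C e ≡ true → X e ≡ true
    covered e Ce with top-covering e Ce
    ... | inj₁ C₀e = ≤ᵛ-elim C₀≤X e C₀e
    ... | inj₂ (l , _ , Ble) = ≤ᵛ-elim (B≤X l) e Ble

  gen-from-blocks : ∀ X i → C₀ ≤ᵛ X → (∀ j → j ≢ i → B j ≤ᵛ X) → a i ≤ᵛ X
  gen-from-blocks X i C₀≤X B≤X = ≤ᵛ-intro covered
    where
    covered : ∀ e → a i e ≡ true → X e ≡ true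
    covered e aie with top-covering e (≤ᵛ-elim (gen≤top i) e aie)
    ... | inj₁ C₀e = ≤ᵛ-elim C₀≤X e C₀e
    ... | inj₂ (l , ale , Ble) = ≤ᵛ-elim (B≤X l l≢i) e Ble
      where
      l≢i : l ≢ i
      l≢i refl = case trans (sym aie) ale of λ ()

  missed-block : ∀ X → C₀ ≤ᵛ X → ¬ (C ≤ᵛ X) → Σ (Fin k) λ i → ¬ (B i ≤ᵛ X)
  missed-block X C₀≤X C≰X = FP.¬∀⟶∃¬ k (λ i → B i ≤ᵛ X) (λ i → B i ≤ᵛ? X) (C≰X ∘ top-from-blocks X C₀≤X)

  other-missed-block : ∀ X i → C₀ ≤ᵛ X → ¬ (a i ≤ᵛ X) → Σ (Fin k) λ j → (j ≢ i) × ¬ (B j ≤ᵛ X)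
  other-missed-block X i C₀≤X ai≰X
    with FP.¬∀⟶∃¬ k (λ j → j ≢ i → B j ≤ᵛ X) (λ j → ¬? (j FP.≟ i) →-dec B j ≤ᵛ? X) (ai≰X ∘ gen-from-blocks X i C₀≤X)
  ... | j , ¬[j≢i→Bj≤X] = j , (λ j≡i → ¬[j≢i→Bj≤X] (λ j≢i → ⊥-elim (j≢i j≡i))) , (λ Bj≤X → ¬[j≢i→Bj≤X] (λ _ → Bj≤X))

  top-from-gen-block : ∀ X i → a i ≤ᵛ X → B i ≤ᵛ X → C ≤ᵛ X
  top-from-gen-block X i a≤X B≤X = ≤ᵛ-intro covered
    where
    covered : ∀ e → C e ≡ true → X e ≡ true
    covered e Ce with a i e in aie
    ... | true = ≤ᵛ-elim a≤X e aie
    ... | false = ≤ᵛ-elim B≤X e (subst (λ c → c ∧ not (a i e) ≡ true) (sym Ce) (cong not aie))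

  module _ (valid : Valid) where
    open Valid valid

    block≤gen : ∀ i j → j ≢ i → B j ≤ᵛ a i
    block≤gen i j j≢i = ≤ᵛ-intro inGen
      where
      inGen : ∀ e → B j e ≡ true → a i e ≡ true
      inGen e Bje with ∨-true (a i e) (a j e) (trans (joinPair i j (j≢i ∘ sym) e) (∧-conicalˡ (C e) _ Bje))
      ... | inj₁ aie = aie
      ... | inj₂ aje = case trans (cong not (sym aje)) (∧-conicalʳ (C e) _ Bje) of λ ()

    blocks-disjoint : ∀ i j → i ≢ j → ∀ e → B i e ≡ true → B j e ≡ true → ⊥
    blocks-disjoint i j i≢j e Bie Bje =
      case trans (cong not (sym (≤ᵛ-elim (block≤gen i j (i≢j ∘ sym)) e Bje))) (∧-conicalʳ (C e) _ Bie) of λ ()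

    top-from-two-gens : ∀ X i j → i ≢ j → a i ≤ᵛ X → a j ≤ᵛ X → C ≤ᵛ X
    top-from-two-gens X i j i≢j ai≤X aj≤X = ≤ᵛ-intro covered
      where
      covered : ∀ e → C e ≡ true → X e ≡ true
      covered e Ce with ∨-true (a i e) (a j e) (trans (joinPair i j i≢j e) Ce)
      ... | inj₁ aie = ≤ᵛ-elim ai≤X e aie
      ... | inj₂ aje = ≤ᵛ-elim aj≤X e aje

    top≰gen : ∀ i j → j ≢ i → ¬ (C ≤ᵛ a i)
    top≰gen i j j≢i C≤ai = proj₁ (incomparable j i j≢i) (≤ᵛ-trans (gen≤top j) C≤ai)

-- Allocating extra variables: slot 0 is shared, and every i with b i = true gets a private
-- slot, so that 1 + count b variables suffice

addIf : Bool → ℕ → ℕ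
addIf true c = suc c
addIf false c = c

count : ∀ {k} → (Fin k → Bool) → ℕ
count {zero} b = 0
count {suc k} b = addIf (b zero) (count (b ∘ suc))

slotStep : ∀ {k} b₀ c → (Fin k → Fin (suc c)) → Fin (suc k) → Fin (suc (addIf b₀ c))
slotStep true c s zero = suc zero
slotStep true c s (suc i) with s i
... | zero = zero
... | suc r = suc (suc r)
slotStep false c s zero = zero
slotStep false c s (suc i) = s i

slot : ∀ {k} (b : Fin k → Bool) → Fin k → Fin (suc (count b))
slot {suc k} b = slotStep (b zero) (count (b ∘ suc)) (slot (b ∘ suc))

slot-shared : ∀ {k} (b : Fin k → Bool) i → b i ≡ false → slot b i ≡ zero
slot-shared {suc k} b i bi with b zero in b₀
slot-shared {suc k} b zero bi | true = case trans (sym b₀) bi of λ ()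
slot-shared {suc k} b (suc i) bi | true rewrite slot-shared (b ∘ suc) i bi = refl
slot-shared {suc k} b zero bi | false = refl
slot-shared {suc k} b (suc i) bi | false = slot-shared (b ∘ suc) i bi

assignStep : ∀ b₀ c → (Fin (suc c) → Bool) → Bool → Fin (suc (addIf b₀ c)) → Bool
assignStep true c v g₀ zero = v zero
assignStep true c v g₀ (suc zero) = g₀
assignStep true c v g₀ (suc (suc r)) = v (suc r)
assignStep false c v g₀ = v

assign : ∀ {k} (b : Fin k → Bool) → Bool → (Fin k → Bool) → Fin (suc (count b)) → Bool
assign {zero} b Y g _ = Y
assign {suc k} b Y g = assignStep (b zero) (count (b ∘ suc)) (assign (b ∘ suc) Y (g ∘ suc)) (g zero)

assign-shared : ∀ {k} (b : Fin k → Bool) Y g → assign b Y g zero ≡ Y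
assign-shared {zero} b Y g = refl
assign-shared {suc k} b Y g with b zero
... | true = assign-shared (b ∘ suc) Y (g ∘ suc)
... | false = assign-shared (b ∘ suc) Y (g ∘ suc)

assign-slot : ∀ {k} (b : Fin k → Bool) Y g i → assign b Y g (slot b i) ≡ (if b i then g i else Y)
assign-slot {suc k} b Y g i with b zero in b₀
assign-slot {suc k} b Y g zero | true rewrite b₀ = refl
assign-slot {suc k} b Y g (suc i) | true with slot (b ∘ suc) i in si
... | zero = trans (sym (cong (assign (b ∘ suc) Y (g ∘ suc)) si)) (assign-slot (b ∘ suc) Y (g ∘ suc) i)
... | suc r = trans (sym (cong (assign (b ∘ suc) Y (g ∘ suc)) si)) (assign-slot (b ∘ suc) Y (g ∘ suc) i)
assign-slot {suc k} b Y g zero | false rewrite b₀ = assign-shared (b ∘ suc) Y (g ∘ suc)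
assign-slot {suc k} b Y g (suc i) | false = assign-slot (b ∘ suc) Y (g ∘ suc) i

-- It is bounded below by the fan value, and the bound is attained with Wᵢ = Y whenever
-- |Bᵢ| ≤ 1, so such switches need no variable of their own.

module ConstructionI {n : ℕ} (k : ℕ) (a : Fin k → Pt n) (valid : Fan.Valid k a) where
  open Fan k a

  big : Fin k → Bool
  big i = 2 N.≤ᵇ card (B i)

  small-card : ∀ i → big i ≡ false → card (B i) ≤ 1
  small-card i small with card (B i)
  ... | zero = N.z≤n
  ... | suc zero = N.s≤s N.z≤n
  ... | suc (suc c) = case small of λ ()

  blockEnergy : Bool → Bool → Pt n → Fin k → ℚ
  blockEnergy W Y X i = 1ℚ *ℚ toℚ Y +ℚ block n (B i) W Y X

  energy : Bool → (Fin k → Bool) → Pt n → ℚ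
  energy Y W X =
    minus2 *ℚ toℚ Y +ℚ (uncovered n C₀ Y X +ℚ (uncovered n C₀ Y X +ℚ sumFin k (λ i → blockEnergy (W i) Y X i)))

  energy-cong : ∀ Y W {W' X X'} → (∀ i → W i ≡ W' i) → X ≈ᵛ X' → energy Y W X ≡ energy Y W' X'
  energy-cong Y W {W'} {X} {X'} W≡W' X≈X' =
    cong₂ (λ u s → minus2 *ℚ toℚ Y +ℚ (u +ℚ (u +ℚ s))) (uncovered-cong n C₀ Y X≈X')
      (sumFin-cong k (λ i → cong (1ℚ *ℚ toℚ Y +ℚ_)
        (trans (cong (λ w → block n (B i) w Y X) (W≡W' i)) (block-cong n (B i) (W' i) Y X≈X'))))

  blockEnergy-nonneg : ∀ X W i → 0ℚ ≤ℚ blockEnergy W true X i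
  blockEnergy-nonneg X W i with B i ≤ᵛ? X
  ... | yes B≤X = QP.+-monoʳ-≤ (1ℚ *ℚ 1ℚ) (block-covered-≥ n (B i) X B≤X W true)
  ... | no B≰X = ≤-+ˡ {1ℚ *ℚ 1ℚ} (QP.≤ᵇ⇒≤ tt) (block-missed-≥ n (B i) X B≰X W true)

  blockEnergy-missed-≥ : ∀ X W i → ¬ (B i ≤ᵛ X) → 1ℚ ≤ℚ blockEnergy W true X i
  blockEnergy-missed-≥ X W i B≰X = QP.+-monoʳ-≤ 1ℚ (block-missed-≥ n (B i) X B≰X W true)

  blockEnergy-off-nonneg : ∀ X W i → 0ℚ ≤ℚ blockEnergy W false X i
  blockEnergy-off-nonneg X true i = ≤-+ˡ QP.≤-refl (≤-+ˡ QP.≤-refl (uncovered-nonneg n (B i) true X))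
  blockEnergy-off-nonneg X false i = ≤-+ˡ QP.≤-refl (≤-+ˡ QP.≤-refl (uncovered-nonneg n (B i) false X))

  blocks-nonneg : ∀ (X : Pt n) (W : Fin k → Bool) → 0ℚ ≤ℚ sumFin k (λ i → blockEnergy (W i) true X i)
  blocks-nonneg X W = sumFin-nonneg k (λ i → blockEnergy-nonneg X (W i) i)

  energy-on : ∀ X W → C₀ ≤ᵛ X → energy true W X ≡ minus2 +ℚ sumFin k (λ i → blockEnergy (W i) true X i)
  energy-on X W C₀≤X rewrite uncovered-covered n C₀ true X C₀≤X =
    cong (minus2 *ℚ 1ℚ +ℚ_) (trans (QP.+-identityˡ (0ℚ +ℚ blocks)) (QP.+-identityˡ blocks))
    where
    blocks : ℚ
    blocks = sumFin k (λ i → blockEnergy (W i) true X i)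

  -- the energy is never below the fan value
  -- with the core covered, the fan value is at most -2 plus the block costs: each
  -- generator not below X forces one more missed block
  blocks-≥ : ∀ v W X → FanValue v X → C₀ ≤ᵛ X → v ≤ℚ minus2 +ℚ sumFin k (λ i → blockEnergy (W i) true X i)
  blocks-≥ v W X fv C₀≤X with C ≤ᵛ? X
  ... | yes C≤X = QP.≤-trans (≡⇒≤ (FanValue.aboveTop fv C≤X)) (≤-+ʳ (blocks-nonneg X W) QP.≤-refl)
  ... | no C≰X with FP.any? (λ i → a i ≤ᵛ? X) | missed-block X C₀≤X C≰X
  ...   | yes gen | i , Bi≰X = QP.≤-trans (≡⇒≤ (FanValue.aboveGen fv C≰X gen))
    (QP.+-monoʳ-≤ minus2 (QP.≤-trans (blockEnergy-missed-≥ X (W i) i Bi≰X) (sumFin-≥term k i (λ l → blockEnergy-nonneg X (W l) l))))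
  ...   | no none | i , Bi≰X with other-missed-block X i C₀≤X (λ ai≤X → none (i , ai≤X))
  ...     | j , j≢i , Bj≰X = QP.≤-trans (≡⇒≤ (FanValue.below fv C≰X none))
    (QP.+-monoʳ-≤ minus2 (QP.≤-trans (QP.+-mono-≤ (blockEnergy-missed-≥ X (W i) i Bi≰X) (blockEnergy-missed-≥ X (W j) j Bj≰X))
      (sumFin-≥two k i j (j≢i ∘ sym) (λ l → blockEnergy-nonneg X (W l) l))))

  -- the energy is never below the fan value: with Y off it is nonnegative, with the core
  -- missed the double penalty makes it nonnegative, and otherwise blocks-≥ applies
  energy-≥ : ∀ v Y W X → FanValue v X → v ≤ℚ energy Y W X
  energy-≥ v false W X fv = QP.≤-trans (FanValue-≤0 fv)
    (≤-+ˡ QP.≤-refl (≤-+ˡ (uncovered-nonneg n C₀ false X) (≤-+ˡ (uncovered-nonneg n C₀ false X)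
      (sumFin-nonneg k (λ i → blockEnergy-off-nonneg X (W i) i)))))
  energy-≥ v true W X fv with C₀ ≤ᵛ? X
  ... | no C₀≰X = QP.≤-trans (FanValue-≤0 fv)
      (QP.+-monoʳ-≤ (minus2 *ℚ 1ℚ) (QP.+-mono-≤ missed (QP.+-mono-≤ missed (blocks-nonneg X W))))
    where
    missed : 1ℚ ≤ℚ uncovered n C₀ true X
    missed = uncovered-missed n C₀ X C₀≰X
  ... | yes C₀≤X = QP.≤-trans (blocks-≥ v W X fv C₀≤X) (≡⇒≤ (sym (energy-on X W C₀≤X)))

  -- the optimal switches: Y is on iff X lies above some generator, and the switch of a
  -- big block is on iff Y is on and X covers the block (small blocks reuse Y)
  fanSwitch : Pt n → Bool
  fanSwitch X = does (C ≤ᵛ? X) ∨ does (FP.any? (λ i → a i ≤ᵛ? X))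

  blockSwitch : Bool → Pt n → Fin k → Bool
  blockSwitch Y X i = if big i then Y ∧ does (B i ≤ᵛ? X) else Y

  fanSwitch-aboveTop : ∀ X → C ≤ᵛ X → fanSwitch X ≡ true
  fanSwitch-aboveTop X C≤X rewrite dec-true (C ≤ᵛ? X) C≤X = refl

  fanSwitch-aboveGen : ∀ X → (Σ (Fin k) λ i → a i ≤ᵛ X) → fanSwitch X ≡ true
  fanSwitch-aboveGen X gen rewrite dec-true (FP.any? (λ i → a i ≤ᵛ? X)) gen with does (C ≤ᵛ? X)
  ... | true = refl
  ... | false = refl

  fanSwitch-below : ∀ X → ¬ (C ≤ᵛ X) → ¬ (Σ (Fin k) λ i → a i ≤ᵛ X) → fanSwitch X ≡ false
  fanSwitch-below X C≰X none rewrite dec-false (C ≤ᵛ? X) C≰X | dec-false (FP.any? (λ i → a i ≤ᵛ? X)) none = refl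

  blockSwitch-off : ∀ X i → blockSwitch false X i ≡ false
  blockSwitch-off X i with big i
  ... | true = refl
  ... | false = refl

  blockEnergy-covered : ∀ X i → B i ≤ᵛ X → blockEnergy (blockSwitch true X i) true X i ≡ 0ℚ
  blockEnergy-covered X i B≤X rewrite dec-true (B i ≤ᵛ? X) B≤X with big i
  ... | true = cong (1ℚ *ℚ 1ℚ +ℚ_) (block-covered n (B i) X B≤X true)
  ... | false = cong (1ℚ *ℚ 1ℚ +ℚ_) (block-covered n (B i) X B≤X true)

  blockEnergy-missed : ∀ X i → ¬ (B i ≤ᵛ X) → blockEnergy (blockSwitch true X i) true X i ≡ 1ℚ
  blockEnergy-missed X i B≰X rewrite dec-false (B i ≤ᵛ? X) B≰X with big i in bigi
  ... | true = cong (1ℚ *ℚ 1ℚ +ℚ_) (block-off n (B i) X true)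
  ... | false = cong (1ℚ *ℚ 1ℚ +ℚ_) (block-small n (B i) X (small-card i bigi) B≰X)

  energy-off : ∀ X W → (∀ i → W i ≡ false) → energy false W X ≡ 0ℚ
  energy-off X W W≡false rewrite uncovered-off n C₀ X =
    cong (λ s → minus2 *ℚ 0ℚ +ℚ (0ℚ +ℚ (0ℚ +ℚ s))) (sumFin-zero k blockOff)
    where
    blockOff : ∀ i → blockEnergy (W i) false X i ≡ 0ℚ
    blockOff i rewrite W≡false i = cong (1ℚ *ℚ 0ℚ +ℚ_) (block-off n (B i) X false)

  energy-attained : ∀ v X → FanValue v X → energy (fanSwitch X) (blockSwitch (fanSwitch X) X) X ≡ v
  energy-attained v X fv = byCases (C ≤ᵛ? X) (FP.any? (λ i → a i ≤ᵛ? X))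
    where
    byCases : Dec (C ≤ᵛ X) → Dec (Σ (Fin k) λ i → a i ≤ᵛ X) →
              energy (fanSwitch X) (blockSwitch (fanSwitch X) X) X ≡ v
    byCases (yes C≤X) _ rewrite fanSwitch-aboveTop X C≤X =
      trans (energy-on X (blockSwitch true X) (≤ᵛ-trans core≤top C≤X))
        (trans (cong (minus2 +ℚ_) (sumFin-zero k (λ i → blockEnergy-covered X i (≤ᵛ-trans (block≤top i) C≤X))))
          (sym (FanValue.aboveTop fv C≤X)))
    byCases (no C≰X) (yes (i , ai≤X)) rewrite fanSwitch-aboveGen X (i , ai≤X) =
      trans (energy-on X (blockSwitch true X) (≤ᵛ-trans (core≤gen i) ai≤X))
        (trans (cong (minus2 +ℚ_) (trans (sumFin-single k i othersCovered) (blockEnergy-missed X i (C≰X ∘ top-from-gen-block X i ai≤X))))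
          (sym (FanValue.aboveGen fv C≰X (i , ai≤X))))
      where
      othersCovered : ∀ j → j ≢ i → blockEnergy (blockSwitch true X j) true X j ≡ 0ℚ
      othersCovered j j≢i = blockEnergy-covered X j (≤ᵛ-trans (block≤gen valid i j j≢i) ai≤X)
    byCases (no C≰X) (no none) rewrite fanSwitch-below X C≰X none =
      trans (energy-off X (blockSwitch false X) (blockSwitch-off X)) (sym (FanValue.below fv C≰X none))

  -- the terms of construction I in polarity pol: y₀ is the fan variable Y and the slot of
  -- block i carries its switch
  module Terms (pol : Bool) where
    open Layout n (suc (count big)) pol

    fanVar : Fin (n + suc (count big))
    fanVar = yVar zero

    switchVar : Fin k → Fin (n + suc (count big))
    switchVar i = yVar (slot big i)

    blockConstraints : Fin k → List (Term (n + suc (count big)))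
    blockConstraints i = unaryTerm 1ℚ pol fanVar ∷ blockTerms (B i) (switchVar i) fanVar

    terms : List (Term (n + suc (count big)))
    terms = unaryTerm minus2 pol fanVar ∷ (penaltyTerms C₀ fanVar ++ˡ (penaltyTerms C₀ fanVar ++ˡ concatFin k blockConstraints))

    eval-terms : ∀ z → evalTerms terms z ≡ energy (read z fanVar) (read z ∘ switchVar) (read z ∘ xVar)
    eval-terms z = cong₂ _+ℚ_ (eval-unaryTerm minus2 pol fanVar z)
      (trans (evalTerms-++ (penaltyTerms C₀ fanVar) _ z) (cong₂ _+ℚ_ (eval-penaltyTerms C₀ fanVar z)
        (trans (evalTerms-++ (penaltyTerms C₀ fanVar) _ z) (cong₂ _+ℚ_ (eval-penaltyTerms C₀ fanVar z)
          (trans (evalTerms-concatFin k blockConstraints z)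
            (sumFin-cong k (λ i → cong₂ _+ℚ_ (eval-unaryTerm 1ℚ pol fanVar z) (eval-blockTerms (B i) (switchVar i) fanVar z))))))))

    eval-terms-at : ∀ x y → evalTerms terms (x ++ᵛ y) ≡
      energy (read (x ++ᵛ y) fanVar) (read (x ++ᵛ y) ∘ switchVar) (λ e → pol xor x e)
    eval-terms-at x y = trans (eval-terms (x ++ᵛ y)) (energy-cong (read (x ++ᵛ y) fanVar) (read (x ++ᵛ y) ∘ switchVar) (λ _ → refl) (read-x x y))

    expressible : (φ : Pt n → ℚ) → (∀ x → FanValue (φ x) (λ e → pol xor x e)) →
                  ExpressibleSub2With φ (suc (count big))
    expressible φ fv = expressible-by-minimum φ terms lower attained
      where
      lower : ∀ x y → φ x ≤ℚ evalTerms terms (x ++ᵛ y)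
      lower x y = QP.≤-trans (energy-≥ (φ x) (read (x ++ᵛ y) fanVar) (read (x ++ᵛ y) ∘ switchVar) (λ e → pol xor x e) (fv x)) (≡⇒≤ (sym (eval-terms-at x y)))
      attained : ∀ x → Σ (Pt (suc (count big))) λ y → evalTerms terms (x ++ᵛ normalForm _ y) ≡ φ x
      attained x = (λ r → pol xor D r) , trans (eval-terms-at x (realise D)) (trans reads (energy-attained (φ x) x' (fv x)))
        where
        x' : Pt n
        x' e = pol xor x e
        Y : Bool
        Y = fanSwitch x'
        D : Pt (suc (count big))
        D = assign big Y (λ i → Y ∧ does (B i ≤ᵛ? x'))
        z : Pt (n + suc (count big))
        z = x ++ᵛ realise D
        reads : energy (read z fanVar) (read z ∘ switchVar) x' ≡ energy Y (blockSwitch Y x') x'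
        reads = trans (cong (λ Y' → energy Y' (read z ∘ switchVar) x') (trans (read-y x D zero) (assign-shared big Y _)))
                      (energy-cong Y (read z ∘ switchVar) (λ i → trans (read-y x D (slot big i)) (assign-slot big Y _ i)) (λ _ → refl))

monomial-covered : ∀ {n} (S X : Pt n) → S ≤ᵛ X → monomial S X ≡ 1ℚ
monomial-covered {zero} S X S≤X = refl
monomial-covered {suc n} S X S≤X with S zero | X zero | S≤X zero
... | true | true | _ = trans (QP.*-identityˡ _) (monomial-covered (S ∘ suc) (X ∘ suc) (S≤X ∘ suc))
... | false | _ | _ = trans (QP.*-identityˡ _) (monomial-covered (S ∘ suc) (X ∘ suc) (S≤X ∘ suc))

monomial-missed : ∀ {n} (S X : Pt n) → ¬ (S ≤ᵛ X) → monomial S X ≡ 0ℚ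
monomial-missed {n} S X S≰X with missed-element S X S≰X
... | e , se , xe = vanishes n S X e se xe
  where
  vanishes : ∀ n (S X : Pt n) e → S e ≡ true → X e ≡ false → monomial S X ≡ 0ℚ
  vanishes (suc n) S X zero se xe rewrite se | xe = QP.*-zeroˡ (monomial (S ∘ suc) (X ∘ suc))
  vanishes (suc n) S X (suc e) se xe =
    trans (cong (factor *ℚ_) (vanishes n (S ∘ suc) (X ∘ suc) e se xe)) (QP.*-zeroʳ factor)
    where
    factor : ℚ
    factor = if S zero then toℚ (X zero) else 1ℚ

monomial-cong : ∀ {n} (S : Pt n) {X X'} → X ≈ᵛ X' → monomial S X ≡ monomial S X'
monomial-cong {zero} S X≈X' = refl
monomial-cong {suc n} S {X} {X'} X≈X' =
  cong₂ (λ x m → (if S zero then toℚ x else 1ℚ) *ℚ m) (X≈X' zero) (monomial-cong (S ∘ suc) (X≈X' ∘ suc))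

block-≥-monomial : ∀ n S W X → -ℚ 1ℚ *ℚ monomial S X ≤ℚ block n S W W X
block-≥-monomial n S W X with S ≤ᵛ? X
... | yes S≤X rewrite monomial-covered S X S≤X = QP.≤-trans (-1≤-W W) (block-covered-≥ n S X S≤X W W)
  where
  -1≤-W : ∀ W → -ℚ 1ℚ ≤ℚ -ℚ toℚ W
  -1≤-W true = QP.≤-refl
  -1≤-W false = QP.≤ᵇ⇒≤ tt
... | no S≰X rewrite monomial-missed S X S≰X = block-missed-≥ n S X S≰X W W

block-at-switch : ∀ n S X → block n S (does (S ≤ᵛ? X)) (does (S ≤ᵛ? X)) X ≡ -ℚ 1ℚ *ℚ monomial S X
block-at-switch n S X = atDecision (S ≤ᵛ? X)
  where
  atDecision : (d : Dec (S ≤ᵛ X)) → block n S (does d) (does d) X ≡ -ℚ 1ℚ *ℚ monomial S X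
  atDecision (yes S≤X) rewrite monomial-covered S X S≤X = block-covered n S X S≤X true
  atDecision (no S≰X) rewrite monomial-missed S X S≰X = block-off n S X false

module ConstructionII {n : ℕ} (k : ℕ) (a : Fin k → Pt n) (pol : Bool) where
  open Layout n k pol

  terms : List (Term (n + k))
  terms = concatFin k (λ i → blockTerms (a i) (yVar i) (yVar i))

  eval-terms-at : ∀ x y → evalTerms terms (x ++ᵛ y) ≡
    sumFin k (λ i → block n (a i) (read (x ++ᵛ y) (yVar i)) (read (x ++ᵛ y) (yVar i)) (λ e → pol xor x e))
  eval-terms-at x y = trans (evalTerms-concatFin k _ (x ++ᵛ y))
    (sumFin-cong k (λ i → trans (eval-blockTerms (a i) (yVar i) (yVar i) (x ++ᵛ y)) (block-cong n (a i) (W i) (W i) (read-x x y))))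
    where
    W : Fin k → Bool
    W i = read (x ++ᵛ y) (yVar i)

  expressible : (φ : Pt n → ℚ) → (∀ x → φ x ≡ sumFin k (λ i → -ℚ 1ℚ *ℚ monomial (a i) (λ e → pol xor x e))) →
                ExpressibleSub2With φ k
  expressible φ φ≡ = expressible-by-minimum φ terms lower attained
    where
    lower : ∀ x y → φ x ≤ℚ evalTerms terms (x ++ᵛ y)
    lower x y = QP.≤-trans (≡⇒≤ (φ≡ x))
      (QP.≤-trans (sumFin-mono k (λ i → block-≥-monomial n (a i) (read (x ++ᵛ y) (yVar i)) (λ e → pol xor x e)))
        (≡⇒≤ (sym (eval-terms-at x y))))
    attained : ∀ x → Σ (Pt k) λ y → evalTerms terms (x ++ᵛ normalForm k y) ≡ φ x
    attained x = (λ r → pol xor D r) , trans (eval-terms-at x (realise D))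
        (trans (sumFin-cong k (λ i → trans (cong (λ w → block n (a i) w w x') (read-y x D i)) (block-at-switch n (a i) x')))
          (sym (φ≡ x)))
      where
      x' : Pt n
      x' e = pol xor x e
      D : Pt k
      D i = does (a i ≤ᵛ? x')

-- coefficient n S f is the Möbius inversion Σ_{T ≤ S} (-1)^{|S∖T|} f(T), computed one
-- coordinate at a time; it is linear in f and recovers the coefficient a_S of any
-- polynomial representation a of f.

coefficient : ∀ n → Pt n → (Pt n → ℚ) → ℚ
coefficient zero S f = f (λ ())
coefficient (suc n) S f with S zero
... | true = coefficient n (S ∘ suc) (λ x → f (true ∷ᵛ x)) +ℚ -ℚ coefficient n (S ∘ suc) (λ x → f (false ∷ᵛ x))
... | false = coefficient n (S ∘ suc) (λ x → f (false ∷ᵛ x))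

coefficient-cong : ∀ n S (f g : Pt n → ℚ) → (∀ x → f x ≡ g x) → coefficient n S f ≡ coefficient n S g
coefficient-cong zero S f g f≡g = f≡g _
coefficient-cong (suc n) S f g f≡g with S zero
... | true = cong₂ (λ u w → u +ℚ -ℚ w) (coefficient-cong n (S ∘ suc) _ _ (λ x → f≡g _)) (coefficient-cong n (S ∘ suc) _ _ (λ x → f≡g _))
... | false = coefficient-cong n (S ∘ suc) _ _ (λ x → f≡g _)

coefficient-+ : ∀ n S (f g : Pt n → ℚ) → coefficient n S (λ x → f x +ℚ g x) ≡ coefficient n S f +ℚ coefficient n S g
coefficient-+ zero S f g = refl
coefficient-+ (suc n) S f g with S zero
... | true = trans (cong₂ (λ u w → u +ℚ -ℚ w) (coefficient-+ n (S ∘ suc) _ _) (coefficient-+ n (S ∘ suc) _ _))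
   (solve 4 (λ a b c d → (a :+ b) :+ (:- (c :+ d)) := (a :+ (:- c)) :+ (b :+ (:- d))) refl
     (coefficient n (S ∘ suc) (λ x → f (true ∷ᵛ x))) (coefficient n (S ∘ suc) (λ x → g (true ∷ᵛ x)))
     (coefficient n (S ∘ suc) (λ x → f (false ∷ᵛ x))) (coefficient n (S ∘ suc) (λ x → g (false ∷ᵛ x))))
... | false = coefficient-+ n (S ∘ suc) _ _

coefficient-scale : ∀ n S c (f : Pt n → ℚ) → coefficient n S (λ x → c *ℚ f x) ≡ c *ℚ coefficient n S f
coefficient-scale zero S c f = refl
coefficient-scale (suc n) S c f with S zero
... | true = trans (cong₂ (λ u w → u +ℚ -ℚ w) (coefficient-scale n (S ∘ suc) c _) (coefficient-scale n (S ∘ suc) c _))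
   (solve 3 (λ c a b → c :* a :+ (:- (c :* b)) := c :* (a :+ (:- b))) refl c
     (coefficient n (S ∘ suc) (λ x → f (true ∷ᵛ x))) (coefficient n (S ∘ suc) (λ x → f (false ∷ᵛ x))))
... | false = coefficient-scale n (S ∘ suc) c _

coefficient-zero : ∀ n S → coefficient n S (λ _ → 0ℚ) ≡ 0ℚ
coefficient-zero zero S = refl
coefficient-zero (suc n) S with S zero
... | true = cong₂ (λ u w → u +ℚ -ℚ w) (coefficient-zero n (S ∘ suc)) (coefficient-zero n (S ∘ suc))
... | false = coefficient-zero n (S ∘ suc)

coefficient-sumFin : ∀ n S k (f : Fin k → Pt n → ℚ) →
  coefficient n S (λ x → sumFin k (λ i → f i x)) ≡ sumFin k (λ i → coefficient n S (f i))
coefficient-sumFin n S zero f = coefficient-zero n S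
coefficient-sumFin n S (suc k) f =
  trans (coefficient-+ n S (f zero) _) (cong (coefficient n S (f zero) +ℚ_) (coefficient-sumFin n S k (f ∘ suc)))

coefficient-sumAll : ∀ n S j (f : Pt j → Pt n → ℚ) →
  coefficient n S (λ x → sumAll j (λ I → f I x)) ≡ sumAll j (λ I → coefficient n S (f I))
coefficient-sumAll n S zero f = refl
coefficient-sumAll n S (suc j) f =
  trans (coefficient-+ n S _ _) (cong₂ _+ℚ_ (coefficient-sumAll n S j _) (coefficient-sumAll n S j _))

monomialCoeff : ∀ n → Bool → Pt n → Pt n → ℚ
monomialCoeff zero pol S I = 1ℚ
monomialCoeff (suc n) pol S I with S zero | I zero
... | true | true = if pol then -ℚ monomialCoeff n pol (S ∘ suc) (I ∘ suc) else monomialCoeff n pol (S ∘ suc) (I ∘ suc)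
... | true | false = 0ℚ
... | false | true = if pol then monomialCoeff n pol (S ∘ suc) (I ∘ suc) else 0ℚ
... | false | false = monomialCoeff n pol (S ∘ suc) (I ∘ suc)

coefficient-monomial : ∀ n pol S I → coefficient n S (λ x → monomial I (λ e → pol xor x e)) ≡ monomialCoeff n pol S I
coefficient-monomial zero pol S I = refl
coefficient-monomial (suc n) pol S I with S zero | I zero
... | true | true =
  trans (cong₂ (λ u w → u +ℚ -ℚ w) (coefficient-scale n (S ∘ suc) (toℚ (pol xor true)) M) (coefficient-scale n (S ∘ suc) (toℚ (pol xor false)) M))
    (trans (cong₂ (λ u w → toℚ (pol xor true) *ℚ u +ℚ -ℚ (toℚ (pol xor false) *ℚ w)) IH IH) (difference pol _))
  where
  M : Pt n → ℚ
  M x = monomial (I ∘ suc) (λ e → pol xor x e)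
  IH : coefficient n (S ∘ suc) M ≡ monomialCoeff n pol (S ∘ suc) (I ∘ suc)
  IH = coefficient-monomial n pol (S ∘ suc) (I ∘ suc)
  difference : ∀ pol c → toℚ (pol xor true) *ℚ c +ℚ -ℚ (toℚ (pol xor false) *ℚ c) ≡ (if pol then -ℚ c else c)
  difference true c = solve 1 (λ c → con 0ℚ :* c :+ (:- (con 1ℚ :* c)) := :- c) refl c
  difference false c = solve 1 (λ c → con 1ℚ :* c :+ (:- (con 0ℚ :* c)) := c) refl c
... | true | false =
  trans (cong₂ (λ u w → u +ℚ -ℚ w) (coefficient-scale n (S ∘ suc) 1ℚ M) (coefficient-scale n (S ∘ suc) 1ℚ M))
    (solve 1 (λ c → con 1ℚ :* c :+ (:- (con 1ℚ :* c)) := con 0ℚ) refl (coefficient n (S ∘ suc) M))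
  where
  M : Pt n → ℚ
  M x = monomial (I ∘ suc) (λ e → pol xor x e)
... | false | true =
  trans (coefficient-scale n (S ∘ suc) (toℚ (pol xor false)) M)
    (trans (cong (toℚ (pol xor false) *ℚ_) (coefficient-monomial n pol (S ∘ suc) (I ∘ suc))) (atZero pol _))
  where
  M : Pt n → ℚ
  M x = monomial (I ∘ suc) (λ e → pol xor x e)
  atZero : ∀ pol c → toℚ (pol xor false) *ℚ c ≡ (if pol then c else 0ℚ)
  atZero true c = QP.*-identityˡ c
  atZero false c = QP.*-zeroˡ c
... | false | false =
  trans (coefficient-scale n (S ∘ suc) 1ℚ M) (trans (QP.*-identityˡ _) (coefficient-monomial n pol (S ∘ suc) (I ∘ suc)))
  where
  M : Pt n → ℚ
  M x = monomial (I ∘ suc) (λ e → pol xor x e)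

monomialCoeff-self : ∀ n pol S → (monomialCoeff n pol S S ≡ 1ℚ) ⊎ (monomialCoeff n pol S S ≡ -ℚ 1ℚ)
monomialCoeff-self zero pol S = inj₁ refl
monomialCoeff-self (suc n) pol S with S zero
... | false = monomialCoeff-self n pol (S ∘ suc)
... | true with pol | monomialCoeff-self n pol (S ∘ suc)
...   | false | r = r
...   | true | inj₁ c≡1 = inj₂ (cong -ℚ_ c≡1)
...   | true | inj₂ c≡-1 = inj₁ (cong -ℚ_ c≡-1)

monomialCoeff-missed : ∀ n pol S I → ¬ (S ≤ᵛ I) → monomialCoeff n pol S I ≡ 0ℚ
monomialCoeff-missed n pol S I S≰I with missed-element S I S≰I
... | e , se , ie = vanishes n pol S I e se ie
  where
  vanishes : ∀ n pol (S I : Pt n) e → S e ≡ true → I e ≡ false → monomialCoeff n pol S I ≡ 0ℚ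
  vanishes (suc n) pol S I zero se ie with S zero | I zero
  vanishes (suc n) pol S I zero refl refl | true | false = refl
  vanishes (suc n) pol S I (suc e) se ie with S zero | I zero | vanishes n pol (S ∘ suc) (I ∘ suc) e se ie
  ... | true | true | c≡0 rewrite c≡0 with pol
  ...   | true = refl
  ...   | false = refl
  vanishes (suc n) pol S I (suc e) se ie | true | false | c≡0 = refl
  vanishes (suc n) pol S I (suc e) se ie | false | true | c≡0 rewrite c≡0 with pol
  ...   | true = refl
  ...   | false = refl
  vanishes (suc n) pol S I (suc e) se ie | false | false | c≡0 = c≡0

sumAll-cong : ∀ j (f g : Pt j → ℚ) → (∀ I → f I ≡ g I) → sumAll j f ≡ sumAll j g
sumAll-cong zero f g f≡g = f≡g _
sumAll-cong (suc j) f g f≡g = cong₂ _+ℚ_ (sumAll-cong j _ _ (λ I → f≡g _)) (sumAll-cong j _ _ (λ I → f≡g _))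

sumAll-zero : ∀ j (f : Pt j → ℚ) → (∀ I → f I ≡ 0ℚ) → sumAll j f ≡ 0ℚ
sumAll-zero zero f f≡0 = f≡0 _
sumAll-zero (suc j) f f≡0 = cong₂ _+ℚ_ (sumAll-zero j _ (λ I → f≡0 _)) (sumAll-zero j _ (λ I → f≡0 _))

sumAll-delta : ∀ n (g : Pt n → ℚ) S → sumAll n (λ I → g I *ℚ monomialCoeff n false S I) ≡ g (normalForm n S)
sumAll-delta zero g S = QP.*-identityʳ _
sumAll-delta (suc n) g S with S zero
... | true = trans (cong₂ _+ℚ_ (sumAll-zero n _ (λ I → QP.*-zeroʳ (g (false ∷ᵛ I))))
                                (sumAll-delta n (λ I → g (true ∷ᵛ I)) (S ∘ suc))) (QP.+-identityˡ _)
... | false = trans (cong₂ _+ℚ_ (sumAll-delta n (λ I → g (false ∷ᵛ I)) (S ∘ suc))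
                                (sumAll-zero n _ (λ I → QP.*-zeroʳ (g (true ∷ᵛ I))))) (QP.+-identityʳ _)

coefficient-polyRep : ∀ n (φ a : Pt n → ℚ) → IsPolyRep φ a → ∀ S → coefficient n S φ ≡ a (normalForm n S)
coefficient-polyRep n φ a rep S =
  trans (coefficient-cong n S φ _ rep)
  (trans (coefficient-sumAll n S n (λ I x → a I *ℚ monomial I x))
  (trans (sumAll-cong n _ _ (λ I → trans (coefficient-scale n S (a I) (monomial I)) (cong (a I *ℚ_) (coefficient-monomial n false S I))))
    (sumAll-delta n a S)))

card-cong : ∀ {n} (S T : Pt n) → S ≈ᵛ T → card S ≡ card T
card-cong {zero} S T S≈T = refl
card-cong {suc n} S T S≈T rewrite S≈T zero = cong (_ +_) (card-cong (S ∘ suc) (T ∘ suc) (S≈T ∘ suc))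

scale-±1-≢0 : ∀ c u → (u ≡ 1ℚ) ⊎ (u ≡ -ℚ 1ℚ) → c ≢ 0ℚ → c *ℚ u ≢ 0ℚ
scale-±1-≢0 c u (inj₁ refl) c≢0 cu≡0 = c≢0 (trans (sym (QP.*-identityʳ c)) cu≡0)
scale-±1-≢0 c u (inj₂ refl) c≢0 cu≡0 =
  c≢0 (QP.neg-injective (trans (cong -ℚ_ (sym (QP.*-identityʳ c))) (trans (QP.neg-distribʳ-* c 1ℚ) cu≡0)))

degree-≥ : ∀ {n} (φ a : Pt n → ℚ) m → IsPolyRep φ a → IsDegree a m →
  ∀ pol k (cs : Fin k → ℚ) (Ss : Fin k → Pt n) (t₀ : Fin k) →
  (∀ x → φ x ≡ sumFin k (λ t → cs t *ℚ monomial (Ss t) (λ e → pol xor x e))) →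
  cs t₀ ≢ 0ℚ → (∀ t → t ≢ t₀ → ¬ (Ss t₀ ≤ᵛ Ss t)) → card (Ss t₀) ≤ m
degree-≥ {n} φ a m rep deg pol k cs Ss t₀ φ≡ c≢0 maximal =
  subst (_≤ m) (card-cong _ _ (normalForm-≈ n S))
    (proj₁ deg (normalForm n S) (coeff≢0 ∘ trans (coefficient-polyRep n φ a rep S)))
  where
  open ≡-Reasoning
  S : Pt n
  S = Ss t₀
  term : Fin k → Pt n → ℚ
  term t x = cs t *ℚ monomial (Ss t) (λ e → pol xor x e)
  coeff : coefficient n S φ ≡ cs t₀ *ℚ monomialCoeff n pol S S
  coeff = begin
    coefficient n S φ
      ≡⟨ coefficient-cong n S φ _ φ≡ ⟩
    coefficient n S (λ x → sumFin k (λ t → term t x))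
      ≡⟨ coefficient-sumFin n S k term ⟩
    sumFin k (λ t → coefficient n S (term t))
      ≡⟨ sumFin-cong k (λ t → trans (coefficient-scale n S (cs t) _) (cong (cs t *ℚ_) (coefficient-monomial n pol S (Ss t)))) ⟩
    sumFin k (λ t → cs t *ℚ monomialCoeff n pol S (Ss t))
      ≡⟨ sumFin-single k t₀ (λ t t≢t₀ → trans (cong (cs t *ℚ_) (monomialCoeff-missed n pol S (Ss t) (maximal t t≢t₀))) (QP.*-zeroʳ (cs t))) ⟩
    cs t₀ *ℚ monomialCoeff n pol S S ∎
  coeff≢0 : coefficient n S φ ≢ 0ℚ
  coeff≢0 = scale-±1-≢0 (cs t₀) _ (monomialCoeff-self n pol S) c≢0 ∘ trans (sym coeff)

kQ : ℕ → ℚ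
kQ k = sumFin k (λ _ → 1ℚ)

module FanPolynomial {n : ℕ} (k : ℕ) (a : Fin k → Pt n) (valid : Fan.Valid k a) where
  open Fan k a

  fanCoeff : Fin (suc k) → ℚ
  fanCoeff zero = kQ k +ℚ minus2
  fanCoeff (suc i) = -ℚ 1ℚ

  fanMonomial : Fin (suc k) → Pt n
  fanMonomial zero = C
  fanMonomial (suc i) = a i

  fan-polynomial : ∀ v X → FanValue v X → v ≡ sumFin (suc k) (λ t → fanCoeff t *ℚ monomial (fanMonomial t) X)
  fan-polynomial v X fv with C ≤ᵛ? X
  ... | yes C≤X = begin
      v                                                                   ≡⟨ FanValue.aboveTop fv C≤X ⟩
      minus2                                                              ≡⟨ solve 2 (λ K m → m := (K :+ m) :* con 1ℚ :+ (:- K)) refl (kQ k) minus2 ⟩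
      (kQ k +ℚ minus2) *ℚ 1ℚ +ℚ -ℚ kQ k                                   ≡⟨ cong₂ (λ u w → (kQ k +ℚ minus2) *ℚ u +ℚ w)
                                                                               (sym (monomial-covered C X C≤X)) (sym (sumFin-neg k (λ _ → 1ℚ))) ⟩
      (kQ k +ℚ minus2) *ℚ monomial C X +ℚ sumFin k (λ _ → -ℚ 1ℚ *ℚ 1ℚ)     ≡⟨ cong ((kQ k +ℚ minus2) *ℚ monomial C X +ℚ_)
                                                                               (sumFin-cong k (λ i → cong (-ℚ 1ℚ *ℚ_) (sym (monomial-covered (a i) X (≤ᵛ-trans (gen≤top i) C≤X))))) ⟩
      (kQ k +ℚ minus2) *ℚ monomial C X +ℚ sumFin k (λ i → -ℚ 1ℚ *ℚ monomial (a i) X) ∎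
    where open ≡-Reasoning
  ... | no C≰X with FP.any? (λ i → a i ≤ᵛ? X)
  ...   | yes (i , ai≤X) = trans (FanValue.aboveGen fv C≰X (i , ai≤X)) (sym (begin
      (kQ k +ℚ minus2) *ℚ monomial C X +ℚ sumFin k (λ j → -ℚ 1ℚ *ℚ monomial (a j) X)
        ≡⟨ cong₂ (λ u w → (kQ k +ℚ minus2) *ℚ u +ℚ w) (monomial-missed C X C≰X) (sumFin-single k i othersMissed) ⟩
      (kQ k +ℚ minus2) *ℚ 0ℚ +ℚ -ℚ 1ℚ *ℚ monomial (a i) X
        ≡⟨ cong₂ _+ℚ_ (QP.*-zeroʳ (kQ k +ℚ minus2)) (cong (-ℚ 1ℚ *ℚ_) (monomial-covered (a i) X ai≤X)) ⟩
      minus1 ∎))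
    where
    open ≡-Reasoning
    othersMissed : ∀ j → j ≢ i → -ℚ 1ℚ *ℚ monomial (a j) X ≡ 0ℚ
    othersMissed j j≢i with a j ≤ᵛ? X
    ... | yes aj≤X = ⊥-elim (C≰X (Fan.top-from-two-gens k a valid X i j (j≢i ∘ sym) ai≤X aj≤X))
    ... | no aj≰X rewrite monomial-missed (a j) X aj≰X = refl
  ...   | no none = trans (FanValue.below fv C≰X none) (sym (
      trans (cong₂ (λ u w → (kQ k +ℚ minus2) *ℚ u +ℚ w) (monomial-missed C X C≰X) (sumFin-zero k allMissed))
            (cong (_+ℚ 0ℚ) (QP.*-zeroʳ (kQ k +ℚ minus2)))))
    where
    allMissed : ∀ j → -ℚ 1ℚ *ℚ monomial (a j) X ≡ 0ℚ
    allMissed j rewrite monomial-missed (a j) X (λ aj≤X → none (j , aj≤X)) = refl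

card-split : ∀ {n} (S T : Pt n) → card S ≡ card (λ e → S e ∧ T e) + card (λ e → S e ∧ not (T e))
card-split {zero} S T = refl
card-split {suc n} S T with S zero | T zero | card-split (S ∘ suc) (T ∘ suc)
... | true | true | IH = cong suc IH
... | true | false | IH = trans (cong suc IH) (sym (NP.+-suc _ _))
... | false | true | IH = IH
... | false | false | IH = IH

card-mono : ∀ {n} (S T : Pt n) → S ≤ᵛ T → card S ≤ card T
card-mono {zero} S T S≤T = N.z≤n
card-mono {suc n} S T S≤T with S zero | T zero | S≤T zero
... | true | true | _ = N.s≤s (card-mono (S ∘ suc) (T ∘ suc) (S≤T ∘ suc))
... | false | true | _ = NP.≤-trans (card-mono (S ∘ suc) (T ∘ suc) (S≤T ∘ suc)) (NP.n≤1+n _)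
... | false | false | _ = card-mono (S ∘ suc) (T ∘ suc) (S≤T ∘ suc)

card-empty : ∀ {n} (S : Pt n) → (∀ e → S e ≡ false) → card S ≡ 0
card-empty {zero} S empty = refl
card-empty {suc n} S empty rewrite empty zero = card-empty (S ∘ suc) (empty ∘ suc)

sumN : ∀ k → (Fin k → ℕ) → ℕ
sumN zero f = 0
sumN (suc k) f = f zero + sumN k (f ∘ suc)

disjoint-sum : ∀ {n} k (B : Fin k → Pt n) (S : Pt n) → (∀ i → B i ≤ᵛ S) →
  (∀ i j → i ≢ j → ∀ e → B i e ≡ true → B j e ≡ true → ⊥) → sumN k (λ i → card (B i)) ≤ card S
disjoint-sum zero B S inS disjoint = N.z≤n
disjoint-sum (suc k) B S inS disjoint =
  subst (sumN (suc k) (λ i → card (B i)) ≤_) (sym (card-split S (B zero)))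
    (NP.+-mono-≤ (card-mono (B zero) _ (≤ᵛ-intro (λ e Be → trans (cong (_∧ B zero e) (≤ᵛ-elim (inS zero) e Be)) Be)))
                 (disjoint-sum k (B ∘ suc) _ (λ i → ≤ᵛ-intro (inRest i))
                   (λ i j i≢j → disjoint (suc i) (suc j) (i≢j ∘ FP.suc-injective))))
  where
  inRest : ∀ i e → B (suc i) e ≡ true → S e ∧ not (B zero e) ≡ true
  inRest i e Be with B zero e in B₀e
  ... | true = ⊥-elim (disjoint zero (suc i) (λ ()) e B₀e Be)
  ... | false rewrite ≤ᵛ-elim (inS (suc i)) e Be = refl

count-big-≤ : ∀ k (f : Fin k → ℕ) → count (λ i → 2 N.≤ᵇ f i) + count (λ i → 2 N.≤ᵇ f i) ≤ sumN k f
count-big-≤ zero f = N.z≤n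
count-big-≤ (suc k) f with 2 N.≤ᵇ f zero in big₀
... | true = subst (_≤ f zero + sumN k (f ∘ suc)) (sym (cong suc (NP.+-suc c c)))
                (NP.+-mono-≤ (NP.≤ᵇ⇒≤ 2 (f zero) (subst T (sym big₀) tt)) (count-big-≤ k (f ∘ suc)))
  where
  c : ℕ
  c = count (λ i → 2 N.≤ᵇ f (suc i))
... | false = NP.≤-trans (count-big-≤ k (f ∘ suc)) (NP.m≤n+m _ (f zero))

half : ∀ p m → p + p ≤ m → p ≤ m / 2
half p m p+p≤m = subst (_≤ m / 2) (DM.m*n/n≡m p 2) (DM./-monoˡ-≤ 2 (subst (_≤ m) (sym (double p)) p+p≤m))
  where
  double : ∀ p → p N.* 2 ≡ p + p
  double p = trans (NP.*-comm p 2) (cong (p +_) (NP.+-identityʳ p))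

count-pos : ∀ {k} (b : Fin k → Bool) → 1 ≤ count b → Σ (Fin k) λ i → b i ≡ true
count-pos {suc k} b 1≤count with b zero in b₀
... | true = zero , b₀
... | false with count-pos (b ∘ suc) 1≤count
...   | i , bi = suc i , bi

module DegreeBounds {n : ℕ} (pol : Bool) (φ A : Pt n → ℚ) (m : ℕ) (rep : IsPolyRep φ A) (deg : IsDegree A m) where

  -- with at least three generators the top survives in the polynomial: |C| ≤ m
  top-≤-degree : ∀ k' (a : Fin (3 + k') → Pt n) (valid : Fan.Valid _ a) →
    (∀ x → Fan.FanValue _ a (φ x) (λ e → pol xor x e)) → card (Fan.C _ a) ≤ m
  top-≤-degree k' a valid fv =
    degree-≥ φ A m rep deg pol _ fanCoeff fanMonomial zero (λ x → fan-polynomial (φ x) _ (fv x)) k-2≢0 topMaximal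
    where
    open Fan _ a
    open FanPolynomial _ a valid
    topMaximal : ∀ t → t ≢ zero → ¬ (C ≤ᵛ fanMonomial t)
    topMaximal zero t≢0 = ⊥-elim (t≢0 refl)
    topMaximal (suc zero) _ = top≰gen valid zero (suc zero) (λ ())
    topMaximal (suc (suc i)) _ = top≰gen valid (suc i) zero (λ ())
    1≤k-2 : 1ℚ ≤ℚ kQ (3 + k') +ℚ minus2
    1≤k-2 = QP.+-monoˡ-≤ minus2 (QP.+-monoʳ-≤ 1ℚ (QP.+-monoʳ-≤ 1ℚ 1≤1+k'))
      where
      1≤1+k' : 1ℚ ≤ℚ 1ℚ +ℚ kQ k'
      1≤1+k' = ≤-+ʳ (sumFin-nonneg k' (λ _ → QP.≤ᵇ⇒≤ tt)) QP.≤-refl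
    k-2≢0 : kQ (3 + k') +ℚ minus2 ≢ 0ℚ
    k-2≢0 k-2≡0 = QP.≤⇒≤ᵇ (subst (1ℚ ≤ℚ_) k-2≡0 1≤k-2)

  big-blocks-≤ : ∀ k' (a : Fin (3 + k') → Pt n) (valid : Fan.Valid _ a) →
    (∀ x → Fan.FanValue _ a (φ x) (λ e → pol xor x e)) → count (ConstructionI.big _ a valid) ≤ m / 2
  big-blocks-≤ k' a valid fv =
    half _ m (NP.≤-trans (count-big-≤ _ (λ i → card (B i)))
               (NP.≤-trans (disjoint-sum _ B C block≤top (blocks-disjoint valid)) (top-≤-degree k' a valid fv)))
    where open Fan _ a

  two-generators : ∀ (a : Fin 2 → Pt n) (valid : Fan.Valid 2 a) →
    (∀ x → Fan.FanValue 2 a (φ x) (λ e → pol xor x e)) →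
    ∀ x → φ x ≡ sumFin 2 (λ i → -ℚ 1ℚ *ℚ monomial (a i) (λ e → pol xor x e))
  two-generators a valid fv x =
    trans (fan-polynomial (φ x) _ (fv x)) (trans (cong (_+ℚ gens) (QP.*-zeroˡ (monomial C x'))) (QP.+-identityˡ gens))
    where
    x' : Pt n
    x' e = pol xor x e
    gens : ℚ
    gens = sumFin 2 (λ i → -ℚ 1ℚ *ℚ monomial (a i) x')
    open Fan 2 a
    open FanPolynomial 2 a valid

  gen-≤-degree : ∀ (a : Fin 2 → Pt n) (valid : Fan.Valid 2 a) →
    (∀ x → Fan.FanValue 2 a (φ x) (λ e → pol xor x e)) → ∀ i → card (a i) ≤ m
  gen-≤-degree a valid fv i =
    degree-≥ φ A m rep deg pol 2 (λ _ → -ℚ 1ℚ) a i (two-generators a valid fv) (λ ()) genMaximal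
    where
    genMaximal : ∀ t → t ≢ i → ¬ (a i ≤ᵛ a t)
    genMaximal t t≢i = proj₁ (Fan.Valid.incomparable valid i t (t≢i ∘ sym))

Bounded : ∀ {n} → (Pt n → ℚ) → ℕ → Set
Bounded φ m = Σ ℕ λ j → (j ≤ 1 + m / 2) × ExpressibleSub2With φ j

viaConstructionI : ∀ {n} k (a : Fin k → Pt n) (valid : Fan.Valid k a) pol (φ : Pt n → ℚ) →
  (∀ x → Fan.FanValue k a (φ x) (λ e → pol xor x e)) → ∀ m →
  count (ConstructionI.big k a valid) ≤ m / 2 → Bounded φ m
viaConstructionI k a valid pol φ fv m bound =
  suc (count (ConstructionI.big k a valid)) , N.s≤s bound , ConstructionI.Terms.expressible k a valid pol φ fv

one-generator-block : ∀ {n} (a : Fin 1 → Pt n) → card (Fan.B 1 a zero) ≡ 0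
one-generator-block a = card-empty _ empty
  where
  empty : ∀ e → Fan.B 1 a zero e ≡ false
  empty e with a zero e
  ... | true = refl
  ... | false = refl

-- with two generators and a big block, construction II needs only 2 ≤ 1 + m/2 variables
two-generators-big-block : ∀ {n} (a : Fin 2 → Pt n) (valid : Fan.Valid 2 a) pol (φ : Pt n → ℚ) →
  (∀ x → Fan.FanValue 2 a (φ x) (λ e → pol xor x e)) → ∀ A m → IsPolyRep φ A → IsDegree A m →
  1 ≤ count (ConstructionI.big 2 a valid) → Bounded φ m
two-generators-big-block a valid pol φ fv A m rep deg someBig =
  2 , N.s≤s (half 1 m 2≤m) , ConstructionII.expressible 2 a pol φ (two-generators a valid fv)
  where
  open DegreeBounds pol φ A m rep deg
  open Fan 2 a
  open ConstructionI 2 a valid using (big)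
  i : Fin 2
  i = proj₁ (count-pos big someBig)
  other : Fin 2 → Fin 2
  other zero = suc zero
  other (suc zero) = zero
  other≢ : ∀ i → other i ≢ i
  other≢ zero ()
  other≢ (suc zero) ()
  2≤|Bi| : 2 ≤ card (B i)
  2≤|Bi| = NP.≤ᵇ⇒≤ 2 (card (B i)) (subst T (sym (proj₂ (count-pos big someBig))) tt)
  2≤m : 2 ≤ m
  2≤m = NP.≤-trans 2≤|Bi| (NP.≤-trans (card-mono (B i) (a (other i)) (block≤gen valid (other i) i (other≢ i ∘ sym)))
                                      (gen-≤-degree a valid fv (other i)))

fan-expressible : ∀ {n} k (a : Fin k → Pt n) (valid : Fan.Valid k a) pol (φ : Pt n → ℚ) →
  (∀ x → Fan.FanValue k a (φ x) (λ e → pol xor x e)) → ∀ A m → IsPolyRep φ A → IsDegree A m → Bounded φ m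
fan-expressible zero a valid pol φ fv A m rep deg = viaConstructionI zero a valid pol φ fv m N.z≤n
fan-expressible (suc zero) a valid pol φ fv A m rep deg =
  viaConstructionI 1 a valid pol φ fv m (subst (_≤ m / 2) (sym noBig) N.z≤n)
  where
  noBig : count (ConstructionI.big 1 a valid) ≡ 0
  noBig rewrite one-generator-block a = refl
fan-expressible (suc (suc zero)) a valid pol φ fv A m rep deg with count (ConstructionI.big 2 a valid) in bigs
... | zero = viaConstructionI 2 a valid pol φ fv m (subst (_≤ m / 2) (sym bigs) N.z≤n)
... | suc _ = two-generators-big-block a valid pol φ fv A m rep deg (subst (1 ≤_) (sym bigs) (N.s≤s N.z≤n))
fan-expressible (suc (suc (suc k'))) a valid pol φ fv A m rep deg =
  viaConstructionI _ a valid pol φ fv m (DegreeBounds.big-blocks-≤ pol φ A m rep deg k' a valid fv)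

-- The fans of Defs: an upper fan over a list F has generators lookup F in polarity false; a
-- lower fan over G has generators ¬(lookup G) in polarity true

any⇒index : ∀ {A : Set} {P : A → Set} (F : List A) → Any P F → Σ (Fin (length F)) λ i → P (lookup F i)
any⇒index F p = Any.index p , AnyP.lookup-index p

index⇒any : ∀ {A : Set} {P : A → Set} (F : List A) → (Σ (Fin (length F)) λ i → P (lookup F i)) → Any P F
index⇒any F (i , p) = lose (∈-lookup i) p

bigJoin-≈ : ∀ {n} (F : List (Pt n)) → bigJoin F ≈ᵛ joinFin (length F) (lookup F)
bigJoin-≈ [] e = refl
bigJoin-≈ (x ∷ F) e = cong (x e ∨_) (bigJoin-≈ F e)

upper-valid : ∀ {n} (F : List (Pt n)) → ValidUpper F → Fan.Valid (length F) (lookup F)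
upper-valid F valid = record
  { incomparable = λ i j i≢j → proj₁ (valid i j i≢j)
  ; joinPair = λ i j i≢j e → trans (proj₂ (valid i j i≢j) e) (bigJoin-≈ F e) }

upper-value : ∀ {n} (F : List (Pt n)) x → Fan.FanValue (length F) (lookup F) (upperFan F x) x
upper-value F x with bigJoin F ≤ᵛ? x | any? (λ a → a ≤ᵛ? x) F
... | yes top | _ = record
  { aboveTop = λ _ → refl
  ; aboveGen = λ C≰x _ → ⊥-elim (C≰x (≤ᵛ-respˡ (bigJoin-≈ F) top))
  ; below = λ C≰x _ → ⊥-elim (C≰x (≤ᵛ-respˡ (bigJoin-≈ F) top)) }
... | no ¬top | yes gen = record
  { aboveTop = λ C≤x → ⊥-elim (¬top (≤ᵛ-respˡ (sym ∘ bigJoin-≈ F) C≤x))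
  ; aboveGen = λ _ _ → refl
  ; below = λ _ none → ⊥-elim (none (any⇒index F gen)) }
... | no ¬top | no ¬gen = record
  { aboveTop = λ C≤x → ⊥-elim (¬top (≤ᵛ-respˡ (sym ∘ bigJoin-≈ F) C≤x))
  ; aboveGen = λ _ gen → ⊥-elim (¬gen (index⇒any F gen))
  ; below = λ _ _ → refl }

complement : ∀ {n} → Pt n → Pt n
complement S e = not (S e)

complement-antitone : ∀ {n} (S T : Pt n) → S ≤ᵛ T → complement T ≤ᵛ complement S
complement-antitone S T S≤T = ≤ᵛ-intro notInS
  where
  notInS : ∀ e → not (T e) ≡ true → not (S e) ≡ true
  notInS e ¬Te with S e in Se
  ... | false = refl
  ... | true = case trans (cong not (sym (≤ᵛ-elim S≤T e Se))) ¬Te of λ ()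

complement-reflects : ∀ {n} (S T : Pt n) → complement T ≤ᵛ complement S → S ≤ᵛ T
complement-reflects S T ¬T≤¬S = ≤ᵛ-intro inT
  where
  inT : ∀ e → S e ≡ true → T e ≡ true
  inT e Se with T e in Te
  ... | true = refl
  ... | false = case trans (sym (≤ᵛ-elim ¬T≤¬S e (cong not Te))) (cong not Se) of λ ()

joinFin-complement : ∀ {n} (G : List (Pt n)) → joinFin (length G) (complement ∘ lookup G) ≈ᵛ complement (bigMeet G)
joinFin-complement [] e = refl
joinFin-complement (g ∷ G) e rewrite joinFin-complement G e with g e
... | true = refl
... | false = refl

lower-valid : ∀ {n} (G : List (Pt n)) → ValidLower G → Fan.Valid (length G) (complement ∘ lookup G)
lower-valid G valid = record
  { incomparable = λ i j i≢j →
      (λ ¬Gi≤¬Gj → proj₂ (proj₁ (valid i j i≢j)) (complement-reflects (lookup G j) (lookup G i) ¬Gi≤¬Gj))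
    , (λ ¬Gj≤¬Gi → proj₁ (proj₁ (valid i j i≢j)) (complement-reflects (lookup G i) (lookup G j) ¬Gj≤¬Gi))
  ; joinPair = λ i j i≢j e →
      trans (deMorgan (lookup G i e) (lookup G j e)) (trans (cong not (proj₂ (valid i j i≢j) e)) (sym (joinFin-complement G e))) }
  where
  deMorgan : ∀ p q → not p ∨ not q ≡ not (p ∧ q)
  deMorgan true q = refl
  deMorgan false q = refl

lower-value : ∀ {n} (G : List (Pt n)) x → Fan.FanValue (length G) (complement ∘ lookup G) (lowerFan G x) (complement x)
lower-value G x with x ≤ᵛ? bigMeet G | any? (λ a → x ≤ᵛ? a) G
... | yes bottom | _ = record
  { aboveTop = λ _ → refl
  ; aboveGen = λ C≰¬x _ → ⊥-elim (C≰¬x (toTop bottom))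
  ; below = λ C≰¬x _ → ⊥-elim (C≰¬x (toTop bottom)) }
  where
  toTop : x ≤ᵛ bigMeet G → joinFin (length G) (complement ∘ lookup G) ≤ᵛ complement x
  toTop x≤meet = ≤ᵛ-respˡ (sym ∘ joinFin-complement G) (complement-antitone x (bigMeet G) x≤meet)
... | no ¬bottom | yes gen = record
  { aboveTop = λ C≤¬x → ⊥-elim (¬bottom (fromTop C≤¬x))
  ; aboveGen = λ _ _ → refl
  ; below = λ _ none → ⊥-elim (none (proj₁ (any⇒index G gen) , complement-antitone x _ (proj₂ (any⇒index G gen)))) }
  where
  fromTop : joinFin (length G) (complement ∘ lookup G) ≤ᵛ complement x → x ≤ᵛ bigMeet G
  fromTop C≤¬x = complement-reflects x (bigMeet G) (≤ᵛ-respˡ (joinFin-complement G) C≤¬x)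
... | no ¬bottom | no ¬gen = record
  { aboveTop = λ C≤¬x → ⊥-elim (¬bottom (fromTop C≤¬x))
  ; aboveGen = λ _ gen → ⊥-elim (¬gen (index⇒any G (proj₁ gen , complement-reflects x _ (proj₂ gen))))
  ; below = λ _ _ → refl }
  where
  fromTop : joinFin (length G) (complement ∘ lookup G) ≤ᵛ complement x → x ≤ᵛ bigMeet G
  fromTop C≤¬x = complement-reflects x (bigMeet G) (≤ᵛ-respˡ (joinFin-complement G) C≤¬x)

theorem1 : (n : ℕ) → 1 ≤ n → (φ : Pt n → ℚ) → IsFan φ →
    (a : Pt n → ℚ) → IsPolyRep φ a → (m : ℕ) → IsDegree a m →
    Σ ℕ λ j → (j ≤ 1 + m / 2) × ExpressibleSub2With φ j
theorem1 n _ φ (inj₁ (F , valid , φ≡upper)) a rep m deg =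
  fan-expressible (length F) (lookup F) (upper-valid F valid) false φ
    (λ x → subst (λ v → Fan.FanValue _ _ v x) (sym (φ≡upper x)) (upper-value F x)) a m rep deg
theorem1 n _ φ (inj₂ (G , valid , φ≡lower)) a rep m deg =
  fan-expressible (length G) (complement ∘ lookup G) (lower-valid G valid) true φ
    (λ x → subst (λ v → Fan.FanValue _ _ v (complement x)) (sym (φ≡lower x)) (lower-value G x)) a m rep deg
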